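{- Let $p$ be a prime with $p\equiv 1 \pmod 4$ and $m\ge 1$ an integer. Then the zero-divisor graph $\Gamma(\mathbb{Z}_{p^m}[i])$ is bipancyclic if and only if $m=1$.
   Context: $\mathbb{Z}_n[i]=\mathbb{Z}[i]/\langle n\rangle=\{a+bi : a,b\in\mathbb{Z}_n\}$ with $i^2=-1$. For a finite commutative ring $R$ with unity, $\Gamma(R)$ has vertex set the nonzero zero-divisors of $R$, distinct $x,y$ adjacent iff $xy=0$. A graph of order $N$ is bipancyclic if it contains a cycle of length $k$ for every even $k$ with $4\le k\le N$. -}

module Defs where

open import Data.Nat as ℕ using (ℕ; zero; suc; _≤_)
open import Data.Nat.DivMod using (_mod_)
import Data.Nat.Divisibility as ℕD
open import Data.Integer as ℤ using (ℤ; +_; _-_)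
open import Data.Integer.Divisibility using (_∣_)
open import Data.Fin using (Fin; toℕ)
open import Data.Fin.Properties using (any?)
open import Data.Empty using (⊥)
open import Data.Product using (_×_; _,_; Σ; ∃; ∃-syntax)
open import Data.List using (List; length; filter; allFin; cartesianProduct)
open import Relation.Nullary using (¬_; Dec; yes; no; _×-dec_; ¬?)
open import Relation.Binary.PropositionalEquality using (_≡_)
open import Function.Definitions using (Injective)
import Data.Nat.Properties as ℕP

-- The ring ℤ_n[i] = {a + b i : a, b ∈ ℤ_n},  i² = -1.
-- An element a + b i is represented by the pair (a , b) of residues.

ℤni : ℕ → Set
ℤni n = Fin n × Fin n

ι : ∀ {n} → Fin n → ℤ
ι a = + toℕ a

IsZero : ∀ {n} → ℤni n → Set
IsZero (a , b) = toℕ a ≡ 0 × toℕ b ≡ 0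

-- x · y = 0 in ℤ_n[i]:  (a+bi)(c+di) = (ac - bd) + (ad + bc) i ≡ 0 (mod n)
ProdZero : ∀ {n} → ℤni n → ℤni n → Set
ProdZero {n} (a , b) (c , d) =
  (+ n ∣ (ι a ℤ.* ι c - ι b ℤ.* ι d)) × (+ n ∣ (ι a ℤ.* ι d ℤ.+ ι b ℤ.* ι c))

IsVertex : ∀ {n} → ℤni n → Set
IsVertex {n} x = ¬ IsZero x × ∃[ y ] (¬ IsZero y × ProdZero x y)

Adj : ∀ {n} → ℤni n → ℤni n → Set
Adj x y = ¬ (x ≡ y) × ProdZero x y

isZero? : ∀ {n} (x : ℤni n) → Dec (IsZero x)
isZero? (a , b) = (toℕ a ℕP.≟ 0) ×-dec (toℕ b ℕP.≟ 0)

∣?ℤ : ∀ (i j : ℤ) → Dec (i ∣ j)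
∣?ℤ i j = ℤ.∣ i ∣ ℕD.∣? ℤ.∣ j ∣

prodZero? : ∀ {n} (x y : ℤni n) → Dec (ProdZero x y)
prodZero? {n} (a , b) (c , d) =
  ∣?ℤ (+ n) (ι a ℤ.* ι c - ι b ℤ.* ι d) ×-dec ∣?ℤ (+ n) (ι a ℤ.* ι d ℤ.+ ι b ℤ.* ι c)

isVertex? : ∀ {n} (x : ℤni n) → Dec (IsVertex x)
isVertex? {n} x with ¬? (isZero? x)
... | no p = no λ { (q , _) → p q }
... | yes p with any? (λ c → any? (λ d → ¬? (isZero? (c , d)) ×-dec prodZero? x (c , d)))
...   | yes ((c , d , r)) = yes (p , (c , d) , r)
...   | no q = no λ { (_ , (c , d) , r) → q (c , d , r) }

elements : (n : ℕ) → List (ℤni n)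
elements n = cartesianProduct (allFin n) (allFin n)

order : ℕ → ℕ
order n = length (filter (isVertex? {n}) (elements n))

next : ∀ {k} → Fin (suc k) → Fin (suc k)
next {k} i = suc (toℕ i) mod suc k

-- a cycle of length suc k: suc k pairwise distinct vertices v₀ … v_k
-- with v_i adjacent to v_{i+1} (indices mod suc k)
record Cycle (n k : ℕ) : Set where
  field
    vtx      : Fin (suc k) → ℤni n
    distinct : Injective _≡_ _≡_ vtx
    isVtx    : ∀ i → IsVertex (vtx i)
    adjacent : ∀ i → Adj (vtx i) (vtx (next i))

HasCycleOfLength : ℕ → ℕ → Set
HasCycleOfLength n zero    = ⊥
HasCycleOfLength n (suc k) = Cycle n k

Bipancyclic : ℕ → Set
Bipancyclic n = ∀ k → 4 ≤ k → k ≤ order n → 2 ℕD.∣ k → HasCycleOfLength n k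

module Submission where

-- Let σ be a square root of -1 modulo p; it exists by pairing each x ∈ {1, …, (p-1)/2}
-- with the y in that range such that x y ≡ ±1: without a root of -1 this is an
-- involution of a set of even size (p-1)/2 with the single fixed point 1.
--
-- m = 1: every zero-divisor of ℤ_p[i] lies on one of the lines t(1 + σ i), t(1 - σ i),
-- and any point of the first line annihilates any point of the second.  So Γ is the
-- complete bipartite graph K_{p-1,p-1}, and alternating between the lines gives a
-- cycle of every even length 2q ≤ 2(p-1).
--
-- m ≥ 2: let z = (σ - i)^m, so p^m ∣ N(z) while z ≢ 0 (mod p).  The (p-1)² p^(2m-3)
-- elements t z + w p with p ∤ t, w are vertices all of whose neighbours lie in the
-- ideal p ℤ_{p^m}[i] of size p^(2m-2).  A bipancyclic Γ would have a cycle missing at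
-- most one vertex; the successors on it of these vertices would be distinct elements of
-- p ℤ_{p^m}[i], which is too small.

open import Defs
open import Data.Nat as ℕ using (ℕ; zero; suc; _^_; _%_; _≤_; _<_; z≤n; s≤s; _∸_; ⌊_/2⌋)
import Data.Nat.Properties as ℕP
import Data.Nat.DivMod as ℕDM
import Data.Nat.Divisibility as ℕD
open import Data.Nat.Primality using (Prime; euclidsLemma; prime⇒nonZero; prime⇒nonTrivial)
open import Data.Nat.Coprimality using (coprime-Bézout; prime⇒coprime)
import Data.Nat.GCD as GCD
import Data.Nat.Tactic.RingSolver as ℕSolver
open import Data.Integer as ℤ using (ℤ; +_; _-_; -_; _+_; _*_)
import Data.Integer.Properties as ℤP
import Data.Integer.DivMod as ℤDM
open import Data.Integer.Divisibility.Signed as S using (_∣_; divides; _∣?_)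
open import Data.Integer.Tactic.RingSolver using (solve)
open import Data.Parity.Base using (Parity; 0ℙ; 1ℙ; _⁻¹)
import Data.Parity.Properties as ℙP
open import Data.Fin as F using (Fin; toℕ)
import Data.Fin.Properties as FP
open import Data.List using (List; []; _∷_; length; lookup; applyUpTo; filter)
open import Data.List.Properties using (length-applyUpTo)
import Data.List.Relation.Unary.All as All
open import Data.List.Relation.Unary.AllPairs using ([]; _∷_)
open import Data.List.Relation.Unary.Any as Any using (here; there; any?)
open import Data.List.Relation.Unary.Any.Properties using (lookup-index)
open import Data.List.Membership.Propositional using (_∈_; find; lose)
open import Data.List.Membership.Propositional.Properties
  using (∈-applyUpTo⁺; ∈-applyUpTo⁻; ∈-filter⁺; ∈-filter⁻; ∈-cartesianProduct⁺; ∈-allFin; ∈-lookup)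
open import Data.List.Relation.Unary.Unique.Propositional using (Unique)
open import Data.List.Relation.Unary.Unique.Propositional.Properties
  using (applyUpTo⁺₁; filter⁺; cartesianProduct⁺; allFin⁺)
open import Data.Product using (_×_; _,_; proj₁; proj₂; ∃-syntax; uncurry)
open import Data.Product.Properties using (≡-dec)
open import Data.Sum using (_⊎_; inj₁; inj₂; [_,_]′)
open import Data.Sum.Properties using (inj₁-injective; inj₂-injective)
open import Data.Empty using (⊥; ⊥-elim)
open import Relation.Nullary using (¬_; Dec; yes; no)
open import Relation.Nullary.Decidable using (_⊎-dec_; map′)
open import Relation.Binary.PropositionalEquality
open import Relation.Binary.Bundles using (Setoid)
open import Relation.Binary.Definitions using (DecidableEquality; tri<; tri≈; tri>)
open import Function.Base using (_∘_; id)
open import Function.Definitions using (Injective)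

infix 4 _≡_mod_
record _≡_mod_ (a b m : ℤ) : Set where
  constructor mod-intro
  field divides-diff : m ∣ a - b
open _≡_mod_ public

-- Rewriting the dividend along an identity (the divisibility comes first, so
-- that the identity can be discharged by the ring solver once both sides are known).
∣-≡ : ∀ {m x y} → m ∣ x → x ≡ y → m ∣ y
∣-≡ d refl = d

mod-via : ∀ {m a b} x → a - b ≡ x → m ∣ x → a ≡ b mod m
mod-via x e d = mod-intro (subst (_ ∣_) (sym e) d)

≡⇒mod : ∀ {m a b} → a ≡ b → a ≡ b mod m
≡⇒mod {m} {a} refl = mod-via (+ 0) (ℤP.+-inverseʳ a) (divides (+ 0) (sym (ℤP.*-zeroˡ m)))

mod-sym : ∀ {m a b} → a ≡ b mod m → b ≡ a mod m
mod-sym {m} {a} {b} (mod-intro d) = mod-via (- (a - b)) (solve (a ∷ b ∷ [])) (S.∣m⇒∣-m d)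

mod-trans : ∀ {m a b c} → a ≡ b mod m → b ≡ c mod m → a ≡ c mod m
mod-trans {m} {a} {b} {c} (mod-intro d) (mod-intro e) =
  mod-via ((a - b) + (b - c)) (solve (a ∷ b ∷ c ∷ [])) (S.∣m∣n⇒∣m+n d e)

mod-setoid : ℤ → Setoid _ _
mod-setoid m = record
  { Carrier       = ℤ
  ; _≈_           = λ a b → a ≡ b mod m
  ; isEquivalence = record { refl = ≡⇒mod refl ; sym = mod-sym ; trans = mod-trans }
  }

module ≡-mod-Reasoning (m : ℤ) where
  open import Relation.Binary.Reasoning.Setoid (mod-setoid m) public

+-cong : ∀ {m a b c d} → a ≡ b mod m → c ≡ d mod m → a + c ≡ b + d mod m
+-cong {m} {a} {b} {c} {d} (mod-intro e) (mod-intro f) =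
  mod-via ((a - b) + (c - d)) (solve (a ∷ b ∷ c ∷ d ∷ [])) (S.∣m∣n⇒∣m+n e f)

neg-cong : ∀ {m a b} → a ≡ b mod m → - a ≡ - b mod m
neg-cong {m} {a} {b} (mod-intro e) = mod-via (- (a - b)) (solve (a ∷ b ∷ [])) (S.∣m⇒∣-m e)

-cong : ∀ {m a b c d} → a ≡ b mod m → c ≡ d mod m → a - c ≡ b - d mod m
-cong e f = +-cong e (neg-cong f)

*-cong : ∀ {m a b c d} → a ≡ b mod m → c ≡ d mod m → a * c ≡ b * d mod m
*-cong {m} {a} {b} {c} {d} (mod-intro e) (mod-intro f) =
  mod-via ((a - b) * c + b * (c - d)) (solve (a ∷ b ∷ c ∷ d ∷ []))
    (S.∣m∣n⇒∣m+n (S.∣m⇒∣m*n c e) (S.∣n⇒∣m*n b f))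

*-congˡ : ∀ {m a b} c → a ≡ b mod m → c * a ≡ c * b mod m
*-congˡ c = *-cong (≡⇒mod {a = c} refl)

*-congʳ : ∀ {m a b} c → a ≡ b mod m → a * c ≡ b * c mod m
*-congʳ c e = *-cong e (≡⇒mod {a = c} refl)

∣⇒≡0 : ∀ {m a} → m ∣ a → a ≡ + 0 mod m
∣⇒≡0 {m} {a} d = mod-via a (ℤP.+-identityʳ a) d

≡0⇒∣ : ∀ {m a} → a ≡ + 0 mod m → m ∣ a
≡0⇒∣ {m} {a} (mod-intro d) = subst (m ∣_) (ℤP.+-identityʳ a) d

multiple≡0 : ∀ {m} a → a * m ≡ + 0 mod m
multiple≡0 a = ∣⇒≡0 (divides a refl)

euclid : ∀ {p} a b → Prime p → + p ∣ a * b → + p ∣ a ⊎ + p ∣ b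
euclid a b pr d with euclidsLemma ℤ.∣ a ∣ ℤ.∣ b ∣ pr (subst (_ ℕD.∣_) (ℤP.abs-* a b) (S.∣⇒∣ᵤ d))
... | inj₁ pa = inj₁ (S.∣ᵤ⇒∣ pa)
... | inj₂ pb = inj₂ (S.∣ᵤ⇒∣ pb)

prime-cancel : ∀ {p x y} → Prime p → ¬ (+ p ∣ x) → + p ∣ x * y → + p ∣ y
prime-cancel {x = x} {y} pr p∤x d = [ (λ p∣x → ⊥-elim (p∤x p∣x)) , (λ p∣y → p∣y) ]′ (euclid x y pr d)

mod-cancel : ∀ {p x a b} → Prime p → ¬ (+ p ∣ x) → x * a ≡ x * b mod + p → a ≡ b mod + p
mod-cancel {p} {x} {a} {b} pr p∤x (mod-intro d) =
  mod-intro (prime-cancel {y = a - b} pr p∤x (∣-≡ d (solve (x ∷ a ∷ b ∷ []))))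

pos-^-suc : ∀ p k → + (p ^ suc k) ≡ + (p ^ k) * + p
pos-^-suc p k = trans (ℤP.pos-* p (p ^ k)) (ℤP.*-comm (+ p) (+ (p ^ k)))

prime-power-cancel : ∀ {p} k a b → Prime p → ¬ (+ p ∣ b) → + (p ^ k) ∣ a * b → + (p ^ k) ∣ a
prime-power-cancel zero a b pr p∤b d = divides a (sym (ℤP.*-identityʳ a))
prime-power-cancel {p} (suc k) a b pr p∤b d
  with prime-cancel pr p∤b (∣-≡ (S.∣-trans (divides (+ (p ^ k)) (pos-^-suc p k)) d) (ℤP.*-comm a b))
... | divides c refl = subst (_∣ c * + p) (sym (pos-^-suc p k)) (S.*-monoˡ-∣ (+ p) p^k∣c)
  where
    instance _ = prime⇒nonZero pr
    swap : ∀ x y z → x * y * z ≡ x * z * y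
    swap x y z = solve (x ∷ y ∷ z ∷ [])
    p^k∣c : + (p ^ k) ∣ c
    p^k∣c = prime-power-cancel k c b pr p∤b
      (S.*-cancelʳ-∣ (+ p) (subst₂ _∣_ (pos-^-suc p k) (swap c (+ p) b) d))

∤-small : ∀ {n a} → 0 < a → a < n → ¬ (+ n ∣ + a)
∤-small 0<a a<n d = ℕD.>⇒∤ {{ℕ.>-nonZero 0<a}} a<n (S.∣⇒∣ᵤ d)

∤⇒0< : ∀ {n x} → ¬ (+ n ∣ + x) → 0 < x
∤⇒0< {x = zero}  n∤0 = ⊥-elim (n∤0 (divides (+ 0) refl))
∤⇒0< {x = suc _} _   = s≤s z≤n

residue-unique-≤ : ∀ {n a b} → b ≤ a → a < n → + a ≡ + b mod + n → a ≡ b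
residue-unique-≤ {n} {a} {b} b≤a a<n (mod-intro d) with a ∸ b in eq
... | zero = ℕP.≤-antisym (ℕP.m∸n≡0⇒m≤n eq) b≤a
... | suc k = ⊥-elim (∤-small (s≤s z≤n) (subst (_< n) eq (ℕP.≤-<-trans (ℕP.m∸n≤m a b) a<n))
                (subst (+ n ∣_) (trans (ℤP.m-n≡m⊖n a b) (trans (ℤP.⊖-≥ b≤a) (cong +_ eq))) d))

residue-unique : ∀ {n a b} → a < n → b < n → + a ≡ + b mod + n → a ≡ b
residue-unique {n} {a} {b} a<n b<n e with ℕP.≤-total b a
... | inj₁ b≤a = residue-unique-≤ b≤a a<n e
... | inj₂ a≤b = sym (residue-unique-≤ a≤b b<n (mod-sym e))

prime-∤-^ : ∀ {p x} → Prime p → ¬ (+ p ∣ x) → ∀ k → ¬ (+ p ∣ x ℤ.^ k)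
prime-∤-^ pr p∤x zero    p∣1 = ∤-small (s≤s z≤n) (ℕ.nonTrivial⇒n>1 _ {{prime⇒nonTrivial pr}}) p∣1
prime-∤-^ pr p∤x (suc k) p∣x^[1+k] = [ p∤x , prime-∤-^ pr p∤x k ]′ (euclid _ _ pr p∣x^[1+k])

^-mono-∣ : ∀ {d x} k → d ∣ x → d ℤ.^ k ∣ x ℤ.^ k
^-mono-∣ zero    _   = S.∣-refl
^-mono-∣ {d} {x} (suc k) d∣x = S.∣-trans (S.*-monoʳ-∣ d (^-mono-∣ k d∣x)) (S.*-monoˡ-∣ (x ℤ.^ k) d∣x)

pos-^ : ∀ p k → + (p ^ k) ≡ (+ p) ℤ.^ k
pos-^ p zero    = refl
pos-^ p (suc k) = trans (ℤP.pos-* p (p ^ k)) (cong (+ p *_) (pos-^ p k))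

module _ {A : Set} (_≟_ : DecidableEquality A) where

  remove : A → List A → List A
  remove a [] = []
  remove a (x ∷ xs) with x ≟ a
  ... | yes _ = xs
  ... | no _  = x ∷ remove a xs

  remove-length : ∀ {a} xs → a ∈ xs → suc (length (remove a xs)) ≡ length xs
  remove-length {a} (x ∷ xs) a∈ with x ≟ a
  remove-length (x ∷ xs) a∈ | yes _ = refl
  remove-length (x ∷ xs) (here refl) | no x≢a = ⊥-elim (x≢a refl)
  remove-length (x ∷ xs) (there a∈) | no _ = cong suc (remove-length xs a∈)

  remove-⊆ : ∀ {a y} xs → y ∈ remove a xs → y ∈ xs
  remove-⊆ {a} (x ∷ xs) y∈ with x ≟ a
  remove-⊆ (x ∷ xs) y∈ | yes _ = there y∈
  remove-⊆ (x ∷ xs) (here e) | no _ = here e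
  remove-⊆ (x ∷ xs) (there y∈) | no _ = there (remove-⊆ xs y∈)

  remove-keeps : ∀ {a y} xs → y ∈ xs → y ≢ a → y ∈ remove a xs
  remove-keeps {a} (x ∷ xs) y∈ y≢a with x ≟ a
  remove-keeps (x ∷ xs) (here refl) y≢a | yes x≡a = ⊥-elim (y≢a x≡a)
  remove-keeps (x ∷ xs) (there y∈) y≢a | yes _ = y∈
  remove-keeps (x ∷ xs) (here e) y≢a | no _ = here e
  remove-keeps (x ∷ xs) (there y∈) y≢a | no _ = there (remove-keeps xs y∈ y≢a)

  remove-unique : ∀ {a} xs → Unique xs → Unique (remove a xs)
  remove-unique [] _ = []
  remove-unique {a} (x ∷ xs) (x≢ ∷ nd) with x ≟ a
  ... | yes _ = nd
  ... | no _  = All.tabulate (λ y∈ → All.lookup x≢ (remove-⊆ xs y∈)) ∷ remove-unique xs nd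

  remove-removes : ∀ {a y} xs → Unique xs → y ∈ remove a xs → y ≢ a
  remove-removes {a} (x ∷ xs) (x≢ ∷ nd) y∈ with x ≟ a
  remove-removes (x ∷ xs) (x≢ ∷ nd) y∈ | yes refl = λ y≡x → All.lookup x≢ y∈ (sym y≡x)
  remove-removes (x ∷ xs) (x≢ ∷ nd) (here refl) | no x≢a = x≢a
  remove-removes (x ∷ xs) (x≢ ∷ nd) (there y∈) | no _ = remove-removes xs nd y∈

  record FixedPointFreeInvolution (T : A → A) (L : List A) : Set where
    field
      closed         : ∀ {x} → x ∈ L → T x ∈ L
      involutive     : ∀ {x} → x ∈ L → T (T x) ≡ x
      no-fixed-point : ∀ {x} → x ∈ L → T x ≢ x

  remove-orbit : ∀ {T y ys} → Unique (y ∷ ys) → FixedPointFreeInvolution T (y ∷ ys) →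
                 FixedPointFreeInvolution T (remove (T y) ys)
  remove-orbit {T} {y} {ys} (y≢ ∷ nd) inv = record
    { closed         = closed′
    ; involutive     = λ x∈ → involutive (inside x∈)
    ; no-fixed-point = λ x∈ → no-fixed-point (inside x∈)
    }
    where
      open FixedPointFreeInvolution inv
      inside : ∀ {x} → x ∈ remove (T y) ys → x ∈ y ∷ ys
      inside x∈ = there (remove-⊆ ys x∈)
      closed′ : ∀ {x} → x ∈ remove (T y) ys → T x ∈ remove (T y) ys
      closed′ {x} x∈ with closed (inside x∈)
      ... | here Tx≡y = ⊥-elim (remove-removes ys nd x∈
                          (trans (sym (involutive (inside x∈))) (cong T Tx≡y)))
      ... | there Tx∈ = remove-keeps ys Tx∈ λ Tx≡Ty → All.lookup y≢ (remove-⊆ ys x∈)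
                          (trans (sym (involutive (here refl))) (trans (cong T (sym Tx≡Ty)) (involutive (inside x∈))))

  involution-even : ∀ n {T} (L : List A) → length L ≡ n → Unique L →
                    FixedPointFreeInvolution T L → ℕ.parity n ≡ 0ℙ
  involution-even zero [] _ _ _ = refl
  involution-even (suc zero) (y ∷ []) _ _ inv with FixedPointFreeInvolution.closed inv (here refl)
  ... | here Ty≡y = ⊥-elim (FixedPointFreeInvolution.no-fixed-point inv (here refl) Ty≡y)
  involution-even (suc (suc n)) {T} (y ∷ ys) len nd@(_ ∷ nd′) inv =
    involution-even n (remove (T y) ys) length-rest (remove-unique ys nd′) (remove-orbit nd inv)
    where
      Ty∈ys : T y ∈ ys
      Ty∈ys with FixedPointFreeInvolution.closed inv (here refl)
      ... | here Ty≡y = ⊥-elim (FixedPointFreeInvolution.no-fixed-point inv (here refl) Ty≡y)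
      ... | there Ty∈ = Ty∈
      length-rest : length (remove (T y) ys) ≡ n
      length-rest = ℕP.suc-injective (trans (remove-length ys Ty∈ys) (ℕP.suc-injective len))

parity-double : ∀ q → ℕ.parity (q ℕ.+ q) ≡ 0ℙ
parity-double q = trans (ℙP.+-homo-+ q q) (proj₁ ℙP.+-inverse (ℕ.parity q))

parity-half-injective : ∀ m n → ℕ.parity m ≡ ℕ.parity n → ⌊ m /2⌋ ≡ ⌊ n /2⌋ → m ≡ n
parity-half-injective zero          zero          _ _ = refl
parity-half-injective (suc zero)    (suc zero)    _ _ = refl
parity-half-injective (suc (suc m)) (suc (suc n)) same-parity same-half =
  cong (suc ∘ suc) (parity-half-injective m n same-parity (ℕP.suc-injective same-half))
parity-half-injective zero          (suc zero)    () _
parity-half-injective (suc zero)    zero          () _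
parity-half-injective zero          (suc (suc _)) _ ()
parity-half-injective (suc zero)    (suc (suc _)) _ ()
parity-half-injective (suc (suc _)) zero          _ ()
parity-half-injective (suc (suc _)) (suc zero)    _ ()

half-< : ∀ m j → m < j ℕ.+ j → ⌊ m /2⌋ < j
half-< zero          (suc j) _ = s≤s z≤n
half-< (suc zero)    (suc j) _ = s≤s z≤n
half-< (suc (suc m)) (suc j) (s≤s m+2<) =
  s≤s (half-< m j (ℕP.≤-pred (subst (suc (suc m) ≤_) (ℕP.+-suc j j) m+2<)))

-- Gaussian integers a + b i, represented as pairs.
𝔾 : Set
𝔾 = ℤ × ℤ

infixl 7 _·_
_·_ : 𝔾 → 𝔾 → 𝔾
(a , b) · (c , d) = (a * c - b * d , a * d + b * c)

infix 4 _∣𝔾_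
_∣𝔾_ : ℤ → 𝔾 → Set
m ∣𝔾 (a , b) = m ∣ a × m ∣ b

·-comm : ∀ z w → z · w ≡ w · z
·-comm (a , b) (c , d) = cong₂ _,_ (solve (a ∷ b ∷ c ∷ d ∷ [])) (solve (a ∷ b ∷ c ∷ d ∷ []))

norm : 𝔾 → ℤ
norm (a , b) = a * a + b * b

norm-· : ∀ z w → norm (z · w) ≡ norm z * norm w
norm-· (a , b) (c , d) = brahmagupta a b c d
  where
    brahmagupta : ∀ a b c d → (a * c - b * d) * (a * c - b * d) + (a * d + b * c) * (a * d + b * c) ≡
                              (a * a + b * b) * (c * c + d * d)
    brahmagupta a b c d = solve (a ∷ b ∷ c ∷ d ∷ [])

infixr 8 _^𝔾_
_^𝔾_ : 𝔾 → ℕ → 𝔾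
z ^𝔾 zero  = (+ 1 , + 0)
z ^𝔾 suc k = z ^𝔾 k · z

norm-^ : ∀ z k → norm (z ^𝔾 k) ≡ norm z ℤ.^ k
norm-^ z zero    = refl
norm-^ z (suc k) = trans (norm-· (z ^𝔾 k) z) (trans (cong (_* norm z) (norm-^ z k)) (ℤP.*-comm _ (norm z)))

lift : ∀ {n} → ℤni n → 𝔾
lift (a , b) = (ι a , ι b)

prodZero⇒∣ : ∀ {n} {x y : ℤni n} → ProdZero x y → + n ∣𝔾 (lift x · lift y)
prodZero⇒∣ (d₁ , d₂) = S.∣ᵤ⇒∣ d₁ , S.∣ᵤ⇒∣ d₂

∣⇒prodZero : ∀ {n} {x y : ℤni n} → + n ∣𝔾 (lift x · lift y) → ProdZero x y
∣⇒prodZero (d₁ , d₂) = S.∣⇒∣ᵤ d₁ , S.∣⇒∣ᵤ d₂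

prodZero-sym : ∀ {n} {x y : ℤni n} → ProdZero x y → ProdZero y x
prodZero-sym {n} {x} {y} pz =
  ∣⇒prodZero {x = y} {x} (subst (+ n ∣𝔾_) (·-comm (lift x) (lift y)) (prodZero⇒∣ {x = x} {y} pz))

module Residues (n : ℕ) .{{_ : ℕ.NonZero n}} where

  red : ℤ → Fin n
  red z = F.fromℕ< (ℤDM.n%ℕd<d z n)

  red-toℕ : ∀ z → toℕ (red z) ≡ z ℤDM.%ℕ n
  red-toℕ z = FP.toℕ-fromℕ< (ℤDM.n%ℕd<d z n)

  red-≡ : ∀ z → ι (red z) ≡ z mod + n
  red-≡ z = mod-sym (mod-via (q * + n) (begin
      z - ι (red z)        ≡⟨ cong₂ _-_ (ℤDM.a≡a%ℕn+[a/ℕn]*n z n) (cong +_ (red-toℕ z)) ⟩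
      r + q * + n - r      ≡⟨ cancel r (q * + n) ⟩
      q * + n              ∎) (divides q refl))
    where
      open ≡-Reasoning
      r = + (z ℤDM.%ℕ n)
      q = z ℤDM./ℕ n
      cancel : ∀ x y → x + y - x ≡ y
      cancel x y = solve (x ∷ y ∷ [])

  red-small : ∀ {t} → t < n → toℕ (red (+ t)) ≡ t
  red-small t<n = trans (red-toℕ (+ _)) (ℕDM.m<n⇒m%n≡m t<n)

  residue-≡ : ∀ {a b : Fin n} → ι a ≡ ι b mod + n → a ≡ b
  residue-≡ {a} {b} e = FP.toℕ-injective (residue-unique (FP.toℕ<n a) (FP.toℕ<n b) e)

  residue-zero : ∀ {a : Fin n} → ι a ≡ + 0 mod + n → toℕ a ≡ 0
  residue-zero {a} e = residue-unique (FP.toℕ<n a) (ℕ.>-nonZero⁻¹ n) e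

  red-ι : ∀ (a : Fin n) → red (ι a) ≡ a
  red-ι a = residue-≡ (red-≡ (ι a))

  reduce : 𝔾 → ℤni n
  reduce (a , b) = red a , red b

  reduce-lift : ∀ (x : ℤni n) → reduce (lift x) ≡ x
  reduce-lift (a , b) = cong₂ _,_ (red-ι a) (red-ι b)

  reduce-≡ : ∀ {a b c d} → reduce (a , b) ≡ reduce (c , d) → a ≡ c mod + n × b ≡ d mod + n
  reduce-≡ {a} {b} {c} {d} e =
    mod-trans (mod-sym (red-≡ a)) (mod-trans (≡⇒mod (cong (ι ∘ proj₁) e)) (red-≡ c)) ,
    mod-trans (mod-sym (red-≡ b)) (mod-trans (≡⇒mod (cong (ι ∘ proj₂) e)) (red-≡ d))

  ∣⇒prodZero-reduce : ∀ z w → + n ∣𝔾 z · w → ProdZero (reduce z) (reduce w)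
  ∣⇒prodZero-reduce (a , b) (c , d) (d₁ , d₂) = ∣⇒prodZero {x = reduce (a , b)} {reduce (c , d)}
    ( ≡0⇒∣ (mod-trans (-cong (*-cong (red-≡ a) (red-≡ c)) (*-cong (red-≡ b) (red-≡ d))) (∣⇒≡0 d₁))
    , ≡0⇒∣ (mod-trans (+-cong (*-cong (red-≡ a) (red-≡ d)) (*-cong (red-≡ b) (red-≡ c))) (∣⇒≡0 d₂)))

  isZero⇒∣ : ∀ {x : ℤni n} → IsZero x → + n ∣𝔾 lift x
  isZero⇒∣ (a≡0 , b≡0) = ≡0⇒∣ (≡⇒mod (cong +_ a≡0)) , ≡0⇒∣ (≡⇒mod (cong +_ b≡0))

  ∣⇒isZero : ∀ {x : ℤni n} → + n ∣𝔾 lift x → IsZero x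
  ∣⇒isZero (d₁ , d₂) = residue-zero (∣⇒≡0 d₁) , residue-zero (∣⇒≡0 d₂)

  isZero-reduce⇒∣ : ∀ z → IsZero (reduce z) → + n ∣𝔾 z
  isZero-reduce⇒∣ (a , b) z≡0 with isZero⇒∣ {reduce (a , b)} z≡0
  ... | d₁ , d₂ = ≡0⇒∣ (mod-trans (mod-sym (red-≡ a)) (∣⇒≡0 d₁)) , ≡0⇒∣ (mod-trans (mod-sym (red-≡ b)) (∣⇒≡0 d₂))

  red-cong : ∀ {a b} → a ≡ b mod + n → red a ≡ red b
  red-cong {a} {b} a≡b = residue-≡ (mod-trans (red-≡ a) (mod-trans a≡b (mod-sym (red-≡ b))))

  prodZero-reduce⇒∣ : ∀ z {y : ℤni n} → ProdZero (reduce z) y → + n ∣𝔾 z · lift y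
  prodZero-reduce⇒∣ (a , b) {c , d} pz with prodZero⇒∣ {x = reduce (a , b)} {c , d} pz
  ... | d₁ , d₂ =
      ≡0⇒∣ (mod-trans (-cong (*-congʳ (ι c) (mod-sym (red-≡ a))) (*-congʳ (ι d) (mod-sym (red-≡ b)))) (∣⇒≡0 d₁))
    , ≡0⇒∣ (mod-trans (+-cong (*-congʳ (ι d) (mod-sym (red-≡ a))) (*-congʳ (ι c) (mod-sym (red-≡ b)))) (∣⇒≡0 d₂))

-- Sums and differences of the
-- four coordinates give p ∣ 2ac, 2bd, 2ad, 2bc.
annihilated-by-conjugates : ∀ {p a b c d} → Prime p → ¬ (+ p ∣ + 2) → ¬ (+ p ∣ a × + p ∣ b) →
  + p ∣ a * c - b * d → + p ∣ a * d + b * c → + p ∣ a * c + b * d → + p ∣ a * d - b * c →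
  + p ∣ c × + p ∣ d
annihilated-by-conjugates {p} {a} {b} {c} {d} pr p∤2 z≢0 zy₁ zy₂ z̄y₁ z̄y₂ = cancel-unit (+ p ∣? a)
  where
    halve : ∀ {x} → + p ∣ + 2 * x → + p ∣ x
    halve = prime-cancel pr p∤2
    twice-sum : ∀ u v → (u + v) + (u - v) ≡ + 2 * u
    twice-sum u v = solve (u ∷ v ∷ [])
    twice-diff : ∀ u v → (u + v) - (u - v) ≡ + 2 * v
    twice-diff u v = solve (u ∷ v ∷ [])
    p∣ac : + p ∣ a * c
    p∣ac = halve (∣-≡ (S.∣m∣n⇒∣m+n z̄y₁ zy₁) (twice-sum (a * c) (b * d)))
    p∣bd : + p ∣ b * d
    p∣bd = halve (∣-≡ (S.∣m∣n⇒∣m-n z̄y₁ zy₁) (twice-diff (a * c) (b * d)))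
    p∣ad : + p ∣ a * d
    p∣ad = halve (∣-≡ (S.∣m∣n⇒∣m+n zy₂ z̄y₂) (twice-sum (a * d) (b * c)))
    p∣bc : + p ∣ b * c
    p∣bc = halve (∣-≡ (S.∣m∣n⇒∣m-n zy₂ z̄y₂) (twice-diff (a * d) (b * c)))
    cancel-unit : Dec (+ p ∣ a) → + p ∣ c × + p ∣ d
    cancel-unit (yes p∣a) = prime-cancel pr p∤b p∣bc , prime-cancel pr p∤b p∣bd
      where p∤b : ¬ (+ p ∣ b)
            p∤b p∣b = z≢0 (p∣a , p∣b)
    cancel-unit (no p∤a) = prime-cancel pr p∤a p∣ac , prime-cancel pr p∤a p∣ad

pos-affine : ∀ c b x → + (c ℕ.+ b ℕ.* x) ≡ + c + + b * + x
pos-affine c b x = trans (ℤP.pos-+ c (b ℕ.* x)) (cong (λ z → + c + z) (ℤP.pos-* b x))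

module _ {p : ℕ} (pr : Prime p) where
  private instance
    p≢0 : ℕ.NonZero p
    p≢0 = prime⇒nonZero pr
  open Residues p

  1<p : 1 < p
  1<p = ℕ.nonTrivial⇒n>1 p {{prime⇒nonTrivial pr}}

  p∤1 : ¬ (+ p ∣ + 1)
  p∤1 = ∤-small (s≤s z≤n) 1<p

  root-unit : ∀ {σ} → + p ∣ σ * σ + + 1 → ¬ (+ p ∣ σ)
  root-unit {σ} p∣σ²+1 p∣σ = p∤1 (S.∣m+n∣m⇒∣n p∣σ²+1 (S.∣m⇒∣m*n σ p∣σ))

  inverse : ∀ {x} → 0 < x → x < p → ∃[ u ] (+ x * u ≡ + 1 mod + p)
  inverse {x@(suc _)} _ x<p with coprime-Bézout (prime⇒coprime pr x<p)
  ... | GCD.Bézout.+- a b 1+bx≡ap = - + b ,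
        mod-via (- + a * + p) (negated (+ x) (+ b) (+ a) (+ p) E) (divides (- + a) refl)
    where
      E : + 1 + + b * + x ≡ + a * + p
      E = trans (sym (pos-affine 1 b x)) (trans (cong +_ 1+bx≡ap) (ℤP.pos-* a p))
      negated : ∀ x b a p → + 1 + b * x ≡ a * p → x * - b - + 1 ≡ - a * p
      negated x b a p e = begin
        x * - b - + 1       ≡⟨ solve (x ∷ b ∷ []) ⟩
        - (+ 1 + b * x)     ≡⟨ cong -_ e ⟩
        - (a * p)           ≡⟨ ℤP.neg-distribˡ-* a p ⟩
        - a * p             ∎
        where open ≡-Reasoning
  ... | GCD.Bézout.-+ a b 1+ap≡bx = + b ,
        mod-via (+ a * + p) (direct (+ x) (+ b) (+ a) (+ p) E) (divides (+ a) refl)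
    where
      E : + b * + x ≡ + 1 + + a * + p
      E = trans (sym (ℤP.pos-* b x)) (trans (cong +_ (sym 1+ap≡bx)) (pos-affine 1 a p))
      direct : ∀ x b a p → b * x ≡ + 1 + a * p → x * b - + 1 ≡ a * p
      direct x b a p e = begin
        x * b - + 1         ≡⟨ cong (_- + 1) (trans (ℤP.*-comm x b) e) ⟩
        + 1 + a * p - + 1   ≡⟨ solve (a ∷ p ∷ []) ⟩
        a * p               ∎
        where open ≡-Reasoning

  _⋈_ : ℕ → ℕ → Set
  x ⋈ y = + x * + y ≡ + 1 mod + p ⊎ + x * + y ≡ - + 1 mod + p

  _⋈?_ : ∀ x y → Dec (x ⋈ y)
  x ⋈? y = map′ mod-intro divides-diff (+ p ∣? _) ⊎-dec map′ mod-intro divides-diff (+ p ∣? _)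

  ⋈-sym : ∀ {x y} → x ⋈ y → y ⋈ x
  ⋈-sym {x} {y} = [ inj₁ ∘ commute , inj₂ ∘ commute ]′
    where commute : ∀ {c} → + x * + y ≡ c mod + p → + y * + x ≡ c mod + p
          commute = mod-trans (≡⇒mod (ℤP.*-comm (+ y) (+ x)))

  -- Pair each x ∈ [1 .. h] with the y ∈ [1 .. h] such that x ⋈ y, where p = 2h + 1.
  -- If -1 is not a square mod p, this is an involution whose only fixed point is 1.
  module Pairing (h : ℕ) (p≡2h+1 : p ≡ suc (h ℕ.+ h))
                 (no-root : ∀ s → s < p → ¬ (+ p ∣ + s * + s + + 1)) where

    L : List ℕ
    L = applyUpTo suc h

    unique-L : Unique L
    unique-L = applyUpTo⁺₁ suc h (λ i<j _ → ℕP.<⇒≢ (s≤s i<j))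

    ∈L⁻ : ∀ {x} → x ∈ L → 0 < x × x ≤ h
    ∈L⁻ x∈ with ∈-applyUpTo⁻ suc x∈
    ... | i , i<h , refl = s≤s z≤n , i<h

    ∈L⁺ : ∀ {x} → 0 < x → x ≤ h → x ∈ L
    ∈L⁺ {suc i} _ 1+i≤h = ∈-applyUpTo⁺ suc 1+i≤h

    sum<p : ∀ {x y} → x ≤ h → y ≤ h → x ℕ.+ y < p
    sum<p x≤h y≤h = subst (_ <_) (sym p≡2h+1) (s≤s (ℕP.+-mono-≤ x≤h y≤h))

    ≤h⇒<p : ∀ {x} → x ≤ h → x < p
    ≤h⇒<p x≤h = ℕP.≤-<-trans (ℕP.m≤m+n _ 0) (sum<p x≤h z≤n)

    ∈L⇒<p : ∀ {x} → x ∈ L → x < p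
    ∈L⇒<p x∈ = ≤h⇒<p (proj₂ (∈L⁻ x∈))

    ∈L⇒p∤ : ∀ {x} → x ∈ L → ¬ (+ p ∣ + x)
    ∈L⇒p∤ x∈ = ∤-small (proj₁ (∈L⁻ x∈)) (∈L⇒<p x∈)

    partner-of-inverse : ∀ {x u} r → r < p → + r ≡ u mod + p → + x * u ≡ + 1 mod + p →
                         ∃[ y ] (y ∈ L × x ⋈ y)
    partner-of-inverse {x} zero _ r≡u xu≡1 = ⊥-elim (p∤1 (≡0⇒∣ (begin
      + 1            ≈⟨ mod-sym xu≡1 ⟩
      + x * _        ≈⟨ *-congˡ (+ x) (mod-sym r≡u) ⟩
      + x * + 0      ≡⟨ ℤP.*-zeroʳ (+ x) ⟩
      + 0            ∎)))
      where open ≡-mod-Reasoning (+ p)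
    partner-of-inverse {x} {u} r@(suc _) r<p r≡u xu≡1 with r ℕ.≤? h
    ... | yes r≤h = r , ∈L⁺ (s≤s z≤n) r≤h , inj₁ (mod-trans (*-congˡ (+ x) r≡u) xu≡1)
    ... | no r≰h = p ∸ r , ∈L⁺ (ℕP.m<n⇒0<n∸m r<p) p∸r≤h , inj₂ (begin
      + x * + (p ∸ r)          ≡⟨ cong (+ x *_) p∸r≡ ⟩
      + x * (+ p - + r)        ≡⟨ distrib (+ x) (+ p) (+ r) ⟩
      + x * + p - + x * + r    ≈⟨ -cong (multiple≡0 (+ x)) (mod-trans (*-congˡ (+ x) r≡u) xu≡1) ⟩
      + 0 - + 1                ≡⟨⟩
      - + 1                    ∎)
      where
        open ≡-mod-Reasoning (+ p)
        p∸r≡ : + (p ∸ r) ≡ + p - + r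
        p∸r≡ = sym (trans (ℤP.m-n≡m⊖n p r) (ℤP.⊖-≥ (ℕP.<⇒≤ r<p)))
        distrib : ∀ a b c → a * (b - c) ≡ a * b - a * c
        distrib a b c = solve (a ∷ b ∷ c ∷ [])
        p∸r≤h : p ∸ r ≤ h
        p∸r≤h = ℕP.≤-trans (ℕP.∸-monoʳ-≤ p (ℕP.≰⇒> r≰h))
                  (ℕP.≤-reflexive (trans (cong (_∸ suc h) p≡2h+1) (ℕP.m+n∸m≡n h h)))

    partner-exists : ∀ {x} → x ∈ L → ∃[ y ] (y ∈ L × x ⋈ y)
    partner-exists {x} x∈ with inverse {x} (proj₁ (∈L⁻ x∈)) (∈L⇒<p x∈)
    ... | u , xu≡1 = partner-of-inverse {x} (toℕ (red u)) (FP.toℕ<n (red u)) (red-≡ u) xu≡1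

    partner-unique : ∀ {x y y'} → x ∈ L → y ∈ L → y' ∈ L → x ⋈ y → x ⋈ y' → y ≡ y'
    partner-unique {x} {y} {y'} x∈ y∈ y'∈ = cases
      where
        open ≡-mod-Reasoning (+ p)
        same-sign : ∀ {c} → + x * + y ≡ c mod + p → + x * + y' ≡ c mod + p → y ≡ y'
        same-sign e e' = residue-unique (∈L⇒<p y∈) (∈L⇒<p y'∈)
                           (mod-cancel pr (∈L⇒p∤ x∈) (mod-trans e (mod-sym e')))
        -- x y ≡ 1 and x y' ≡ -1 would give p ∣ y + y', but 0 < y + y' < p.
        opposite-signs : ∀ {z z'} → z ∈ L → z' ∈ L →
                         + x * + z ≡ + 1 mod + p → + x * + z' ≡ - + 1 mod + p → ⊥
        opposite-signs {z} {z'} z∈ z'∈ e e' =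
          ∤-small (ℕP.<-≤-trans (proj₁ (∈L⁻ z∈)) (ℕP.m≤m+n z z')) (sum<p (proj₂ (∈L⁻ z∈)) (proj₂ (∈L⁻ z'∈)))
            (prime-cancel pr (∈L⇒p∤ x∈) (≡0⇒∣ (begin
              + x * + (z ℕ.+ z')           ≡⟨ cong (+ x *_) (ℤP.pos-+ z z') ⟩
              + x * (+ z + + z')           ≡⟨ ℤP.*-distribˡ-+ (+ x) (+ z) (+ z') ⟩
              + x * + z + + x * + z'       ≈⟨ +-cong e e' ⟩
              + 0                          ∎)))
        cases : x ⋈ y → x ⋈ y' → y ≡ y'
        cases (inj₁ e) (inj₁ e') = same-sign e e'
        cases (inj₂ e) (inj₂ e') = same-sign e e'
        cases (inj₁ e) (inj₂ e') = ⊥-elim (opposite-signs y∈ y'∈ e e')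
        cases (inj₂ e) (inj₁ e') = ⊥-elim (opposite-signs y'∈ y∈ e' e)

    -- x² ≡ -1 is excluded by assumption, and x² ≡ 1 forces x ≡ ±1, i.e. x = 1 in L.
    self-partner : ∀ {x} → x ∈ L → x ⋈ x → x ≡ 1
    self-partner {x} x∈ (inj₂ x²≡-1) =
      ⊥-elim (no-root x (∈L⇒<p x∈) (≡0⇒∣ (mod-trans (+-cong x²≡-1 (≡⇒mod {a = + 1} refl)) (≡⇒mod refl))))
    self-partner {x} x∈ (inj₁ x²≡1) =
      [ (λ p∣x-1 → residue-unique (∈L⇒<p x∈) 1<p (mod-intro p∣x-1))
      , (λ p∣x+1 → ⊥-elim (∤-small (ℕP.m≤n+m 1 x) x+1<p (subst (+ p ∣_) (sym (ℤP.pos-+ x 1)) p∣x+1)))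
      ]′ (euclid (+ x - + 1) (+ x + + 1) pr (≡0⇒∣ (begin
        (+ x - + 1) * (+ x + + 1)    ≡⟨ difference-of-squares (+ x) ⟩
        + x * + x - + 1              ≈⟨ -cong x²≡1 (≡⇒mod {a = + 1} refl) ⟩
        + 0                          ∎)))
      where
        open ≡-mod-Reasoning (+ p)
        difference-of-squares : ∀ a → (a - + 1) * (a + + 1) ≡ a * a - + 1
        difference-of-squares a = solve (a ∷ [])
        x+1<p : x ℕ.+ 1 < p
        x+1<p = sum<p (proj₂ (∈L⁻ x∈)) (ℕP.≤-trans (proj₁ (∈L⁻ x∈)) (proj₂ (∈L⁻ x∈)))

    -- The pairing as a function; its values outside L are irrelevant.
    partner : ℕ → ℕ
    partner x with any? (x ⋈?_) L
    ... | yes has-partner = proj₁ (find has-partner)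
    ... | no _            = x

    partner-spec : ∀ {x} → x ∈ L → partner x ∈ L × x ⋈ partner x
    partner-spec {x} x∈ with any? (x ⋈?_) L
    ... | yes has-partner = proj₂ (find has-partner)
    ... | no no-partner   = ⊥-elim (no-partner (let y , y∈ , x⋈y = partner-exists x∈ in lose y∈ x⋈y))

    partner-involutive : ∀ {x} → x ∈ L → partner (partner x) ≡ x
    partner-involutive {x} x∈ with partner-spec x∈
    ... | y∈ , x⋈y = partner-unique y∈ (proj₁ (partner-spec y∈)) x∈ (proj₂ (partner-spec y∈)) (⋈-sym {x} x⋈y)

    partner-on-L∖1 : 1 ≤ h → FixedPointFreeInvolution ℕP._≟_ partner (remove ℕP._≟_ 1 L)
    partner-on-L∖1 1≤h = record
      { closed         = λ x∈′ → remove-keeps ℕP._≟_ L (proj₁ (partner-spec (inside x∈′))) (λ px≡1 →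
                           remove-removes ℕP._≟_ L unique-L x∈′
                             (trans (sym (partner-involutive (inside x∈′))) (trans (cong partner px≡1) partner-1)))
      ; involutive     = λ x∈′ → partner-involutive (inside x∈′)
      ; no-fixed-point = λ {x} x∈′ px≡x → remove-removes ℕP._≟_ L unique-L x∈′
                           (self-partner (inside x∈′) (subst (x ⋈_) px≡x (proj₂ (partner-spec (inside x∈′)))))
      }
      where
        inside : ∀ {x} → x ∈ remove ℕP._≟_ 1 L → x ∈ L
        inside = remove-⊆ ℕP._≟_ L
        1∈L : 1 ∈ L
        1∈L = ∈L⁺ (s≤s z≤n) 1≤h
        partner-1 : partner 1 ≡ 1
        partner-1 = partner-unique 1∈L (proj₁ (partner-spec 1∈L)) 1∈L (proj₂ (partner-spec 1∈L)) (inj₁ (≡⇒mod refl))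

    -- Hence h - 1 is even, so h is odd.
    h-odd : 1 ≤ h → ℕ.parity h ≡ 0ℙ → ⊥
    h-odd 1≤h h-even = ℙP.p≢p⁻¹ (ℕ.parity h) (trans h-even (trans (sym L∖1-even)
                         (trans (sym (ℙP.suc-homo-⁻¹ (length L∖1))) (cong (λ n → ℕ.parity n ⁻¹) length-L∖1))))
      where
        L∖1 = remove ℕP._≟_ 1 L
        length-L∖1 : suc (length L∖1) ≡ h
        length-L∖1 = trans (remove-length ℕP._≟_ L (∈L⁺ (s≤s z≤n) 1≤h)) (length-applyUpTo suc h)
        L∖1-even : ℕ.parity (length L∖1) ≡ 0ℙ
        L∖1-even = involution-even ℕP._≟_ _ L∖1 refl
                     (remove-unique ℕP._≟_ L unique-L)
                     (partner-on-L∖1 1≤h)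

  one-mod-four : p % 4 ≡ 1 → ∃[ q ] (1 ≤ q × p ≡ suc (q ℕ.* 4))
  one-mod-four p%4≡1 = q , 1≤q , p≡1+4q
    where
      q = p ℕ./ 4
      p≡1+4q : p ≡ suc (q ℕ.* 4)
      p≡1+4q = trans (ℕDM.m≡m%n+[m/n]*n p 4) (cong (ℕ._+ q ℕ.* 4) p%4≡1)
      1≤q : 1 ≤ q
      1≤q with q | p≡1+4q
      ... | zero  | p≡1 = ⊥-elim (ℕP.<-irrefl (sym p≡1) 1<p)
      ... | suc _ | _   = s≤s z≤n

  -- For p ≡ 1 (mod 4), -1 is a square modulo p: otherwise, with p = 2h + 1 and h = 2q,
  -- the pairing would make h odd.
  sqrt-minus-one : p % 4 ≡ 1 → ∃[ s ] (+ p ∣ + s * + s + + 1)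
  sqrt-minus-one p%4≡1 with FP.any? (λ (s : Fin p) → + p ∣? + toℕ s * + toℕ s + + 1) | one-mod-four p%4≡1
  ... | yes (s , p∣s²+1) | _ = toℕ s , p∣s²+1
  ... | no no-root | q , 1≤q , p≡1+4q =
    ⊥-elim (Pairing.h-odd (q ℕ.+ q) p≡2h+1 no-root′ (ℕP.≤-trans 1≤q (ℕP.m≤m+n q q)) (parity-double q))
    where
      four-q : ∀ q → q ℕ.* 4 ≡ (q ℕ.+ q) ℕ.+ (q ℕ.+ q)
      four-q = ℕSolver.solve-∀
      p≡2h+1 : p ≡ suc ((q ℕ.+ q) ℕ.+ (q ℕ.+ q))
      p≡2h+1 = trans p≡1+4q (cong suc (four-q q))
      no-root′ : ∀ s → s < p → ¬ (+ p ∣ + s * + s + + 1)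
      no-root′ s s<p p∣ = no-root (F.fromℕ< s<p ,
        subst (λ t → + p ∣ + t * + t + + 1) (sym (FP.toℕ-fromℕ< s<p)) p∣)

vertices : (n : ℕ) → List (ℤni n)
vertices n = filter (isVertex? {n}) (elements n)

∈-vertices : ∀ {n} {x : ℤni n} → IsVertex x → x ∈ vertices n
∈-vertices {x = a , b} v = ∈-filter⁺ isVertex? (∈-cartesianProduct⁺ (∈-allFin a) (∈-allFin b)) v

vertices-unique : ∀ n → Unique (vertices n)
vertices-unique n = filter⁺ isVertex? (cartesianProduct⁺ (allFin⁺ n) (allFin⁺ n))

lookup-injective : ∀ {A : Set} {xs : List A} → Unique xs → ∀ i j → lookup xs i ≡ lookup xs j → i ≡ j
lookup-injective (_ ∷ _) F.zero F.zero _ = refl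
lookup-injective (x≢ ∷ _) F.zero (F.suc j) e = ⊥-elim (All.lookup x≢ (∈-lookup j) e)
lookup-injective (x≢ ∷ _) (F.suc i) F.zero e = ⊥-elim (All.lookup x≢ (∈-lookup i) (sym e))
lookup-injective (_ ∷ u) (F.suc i) (F.suc j) e = cong F.suc (lookup-injective u i j e)

order-≥ : ∀ {n a} (f : Fin a → ℤni n) → Injective _≡_ _≡_ f → (∀ i → IsVertex (f i)) → a ≤ order n
order-≥ {n} f f-inj f-vtx = FP.injective⇒≤ {f = position} position-inj
  where
    position : Fin _ → Fin (order n)
    position i = Any.index (∈-vertices (f-vtx i))
    position-inj : Injective _≡_ _≡_ position
    position-inj {i} {j} e = f-inj (trans (lookup-index (∈-vertices (f-vtx i)))
                               (trans (cong (lookup (vertices n)) e) (sym (lookup-index (∈-vertices (f-vtx j))))))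

order-≤ : ∀ {n b} (g : ℤni n → Fin b) → (∀ {x y} → IsVertex x → IsVertex y → g x ≡ g y → x ≡ y) →
          order n ≤ b
order-≤ {n} g g-inj = FP.injective⇒≤ {f = g ∘ lookup (vertices n)}
  (λ {i} {j} e → lookup-injective (vertices-unique n) i j (g-inj (is-vertex i) (is-vertex j) e))
  where
    is-vertex : ∀ i → IsVertex (lookup (vertices n) i)
    is-vertex i = proj₂ (∈-filter⁻ isVertex? {xs = elements n} (∈-lookup i))

next-cases : ∀ {k} (i : Fin (suc k)) →
             (toℕ i < k × toℕ (next i) ≡ suc (toℕ i)) ⊎ (toℕ i ≡ k × toℕ (next i) ≡ 0)
next-cases {k} i with ℕP.<-cmp (toℕ i) k
... | tri< i<k _ _ = inj₁ (i<k , trans (FP.toℕ-fromℕ< _) (ℕDM.m<n⇒m%n≡m (s≤s i<k)))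
... | tri≈ _ i≡k _ = inj₂ (i≡k , trans (FP.toℕ-fromℕ< _)
                       (trans (cong (λ z → suc z % suc k) i≡k) (ℕDM.n%n≡0 (suc k))))
... | tri> _ _ i>k = ⊥-elim (ℕP.<⇒≱ i>k (ℕP.≤-pred (FP.toℕ<n i)))

next-injective : ∀ {k} → Injective _≡_ _≡_ (next {k})
next-injective {k} {i} {j} e with next-cases i | next-cases j
... | inj₁ (_ , a) | inj₁ (_ , b) = FP.toℕ-injective (ℕP.suc-injective (trans (sym a) (trans (cong toℕ e) b)))
... | inj₁ (_ , a) | inj₂ (_ , b) = ⊥-elim (ℕP.1+n≢0 (trans (sym a) (trans (cong toℕ e) b)))
... | inj₂ (_ , a) | inj₁ (_ , b) = ⊥-elim (ℕP.1+n≢0 (trans (sym b) (trans (cong toℕ (sym e)) a)))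
... | inj₂ (x , _) | inj₂ (y , _) = FP.toℕ-injective (trans x (sym y))

module _ {n K : ℕ} (C : Cycle n K) where
  open Cycle C

  OnCycle : ℤni n → Set
  OnCycle x = ∃[ i ] (vtx i ≡ x)

  onCycle? : ∀ x → Dec (OnCycle x)
  onCycle? x = FP.any? (λ i → ≡-dec FP._≟_ FP._≟_ (vtx i) x)

  -- When the cycle misses at most one vertex of the graph, any two vertices off
  -- the cycle coincide: otherwise the cycle and both of them are K + 3 vertices.
  off-cycle-unique : order n ≤ suc (suc K) → ∀ {x y} → IsVertex x → IsVertex y →
                     ¬ OnCycle x → ¬ OnCycle y → x ≡ y
  off-cycle-unique ord {x} {y} x-vtx y-vtx x∉ y∉ with ≡-dec FP._≟_ FP._≟_ x y
  ... | yes x≡y = x≡y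
  ... | no x≢y = ⊥-elim (ℕP.<⇒≱ (s≤s ℕP.≤-refl) (ℕP.≤-trans (order-≥ family family-inj family-vtx) ord))
    where
      family : Fin (suc (suc (suc K))) → ℤni n
      family F.zero             = x
      family (F.suc F.zero)     = y
      family (F.suc (F.suc i))  = vtx i
      family-inj : Injective _≡_ _≡_ family
      family-inj {F.zero}          {F.zero}          _ = refl
      family-inj {F.zero}          {F.suc F.zero}    e = ⊥-elim (x≢y e)
      family-inj {F.zero}          {F.suc (F.suc j)} e = ⊥-elim (x∉ (j , sym e))
      family-inj {F.suc F.zero}    {F.zero}          e = ⊥-elim (x≢y (sym e))
      family-inj {F.suc F.zero}    {F.suc F.zero}    _ = refl
      family-inj {F.suc F.zero}    {F.suc (F.suc j)} e = ⊥-elim (y∉ (j , sym e))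
      family-inj {F.suc (F.suc i)} {F.zero}          e = ⊥-elim (x∉ (i , e))
      family-inj {F.suc (F.suc i)} {F.suc F.zero}    e = ⊥-elim (y∉ (i , e))
      family-inj {F.suc (F.suc i)} {F.suc (F.suc j)} e = cong (F.suc ∘ F.suc) (distinct e)
      family-vtx : ∀ i → IsVertex (family i)
      family-vtx F.zero            = x-vtx
      family-vtx (F.suc F.zero)    = y-vtx
      family-vtx (F.suc (F.suc i)) = isVtx i

  -- Each X j on the cycle determines its successor
  -- on the cycle, which lies in D; hence there are at most d + 1 of them.
  neighbourhood-bound : order n ≤ suc (suc K) →
    ∀ {M d} (X : Fin M → ℤni n) → Injective _≡_ _≡_ X → (∀ j → IsVertex (X j)) →
    (D : ℤni n → Set) → (∀ j y → ProdZero (X j) y → D y) →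
    (code : ℤni n → Fin d) → (∀ {y y'} → D y → D y' → code y ≡ code y' → y ≡ y') →
    M ≤ suc d
  neighbourhood-bound ord {M} {d} X X-inj X-vtx D X-nbrs code code-inj =
    FP.injective⇒≤ {f = λ j → slot j (onCycle? (X j))} (λ {j} {j'} → slot-inj j j' _ _)
    where
      slot : ∀ j → Dec (OnCycle (X j)) → Fin (suc d)
      slot j (yes (i , _)) = F.suc (code (vtx (next i)))
      slot j (no _)        = F.zero
      successor-in-D : ∀ j i → vtx i ≡ X j → D (vtx (next i))
      successor-in-D j i e = X-nbrs j _ (subst (λ x → ProdZero x (vtx (next i))) e (proj₂ (adjacent i)))
      slot-inj : ∀ j j' (d : Dec (OnCycle (X j))) (d' : Dec (OnCycle (X j'))) → slot j d ≡ slot j' d' → j ≡ j'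
      slot-inj j j' (yes (i , e)) (yes (i' , e')) s = X-inj (trans (sym e) (trans (cong vtx
        (next-injective (distinct (code-inj (successor-in-D j i e) (successor-in-D j' i' e') (FP.suc-injective s)))))
        e'))
      slot-inj j j' (no j∉) (no j'∉) _ = X-inj (off-cycle-unique ord (X-vtx j) (X-vtx j') j∉ j'∉)

double-half-≤ : ∀ N → ⌊ N /2⌋ ℕ.+ ⌊ N /2⌋ ≤ N × N ≤ suc (⌊ N /2⌋ ℕ.+ ⌊ N /2⌋)
double-half-≤ zero          = z≤n , z≤n
double-half-≤ (suc zero)    = z≤n , s≤s z≤n
double-half-≤ (suc (suc N)) with double-half-≤ N
... | lower , upper = subst (_≤ suc (suc N)) (sym (ℕP.+-suc (suc h) h)) (s≤s (s≤s lower))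
                    , subst (suc (suc N) ≤_) (cong suc (sym (ℕP.+-suc (suc h) h))) (s≤s (s≤s upper))
  where h = ⌊ N /2⌋

near-spanning-cycle : ∀ {n} → Bipancyclic n → 5 ≤ order n → ∃[ K ] (Cycle n K × order n ≤ suc (suc K))
near-spanning-cycle {n} bip 5≤N with double-half-≤ (order n)
... | 2h≤N , N≤2h+1 = cycle-of (⌊ order n /2⌋) 2h≤N N≤2h+1 (ℕP.≤-pred (ℕP.≤-trans 5≤N N≤2h+1))
  where
    cycle-of : ∀ h → h ℕ.+ h ≤ order n → order n ≤ suc (h ℕ.+ h) → 4 ≤ h ℕ.+ h →
               ∃[ K ] (Cycle n K × order n ≤ suc (suc K))
    cycle-of (suc h) 2h≤N N≤2h+1 4≤2h =
      h ℕ.+ suc h , bip (suc h ℕ.+ suc h) 4≤2h 2h≤N (ℕD.divides (suc h) (double≡*2 (suc h))) , N≤2h+1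
      where double≡*2 : ∀ x → x ℕ.+ x ≡ x ℕ.* 2
            double≡*2 x = trans (cong (x ℕ.+_) (sym (ℕP.+-identityʳ x))) (ℕP.*-comm 2 x)

remQuot-injective : ∀ {m} n {i j : Fin (m ℕ.* n)} → F.remQuot {m} n i ≡ F.remQuot n j → i ≡ j
remQuot-injective {m} n {i} {j} e =
  trans (sym (FP.combine-remQuot {m} n i)) (trans (cong (uncurry F.combine) e) (FP.combine-remQuot {m} n j))

-- Enumerating the numbers below p K that are prime to p, as a + 1 + p q with a < p - 1, q < K.
module _ {p pm : ℕ} (p≡1+pm : p ≡ suc pm) where
  private instance
    p≢0 : ℕ.NonZero p
    p≢0 = subst ℕ.NonZero (sym p≡1+pm) _

  unit-below : ∀ K → Fin (pm ℕ.* K) → ℕ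
  unit-below K i = suc (toℕ (proj₁ (F.remQuot {pm} K i))) ℕ.+ p ℕ.* toℕ (proj₂ (F.remQuot {pm} K i))

  private
    1+a<p : ∀ (a : Fin pm) → suc (toℕ a) < p
    1+a<p a = subst (suc (toℕ a) <_) (sym p≡1+pm) (s≤s (FP.toℕ<n a))

    unit-mod : ∀ (a : Fin pm) q → (suc (toℕ a) ℕ.+ p ℕ.* q) % p ≡ suc (toℕ a)
    unit-mod a q = trans (cong (λ x → (suc (toℕ a) ℕ.+ x) % p) (ℕP.*-comm p q))
                     (trans (ℕDM.[m+kn]%n≡m%n (suc (toℕ a)) q p) (ℕDM.m<n⇒m%n≡m (1+a<p a)))

  unit-below-< : ∀ K i → unit-below K i < p ℕ.* K
  unit-below-< K i = ℕP.<-≤-trans (ℕP.+-monoˡ-< (p ℕ.* toℕ q) (1+a<p a))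
                       (ℕP.≤-trans (ℕP.≤-reflexive (sym (ℕP.*-suc p (toℕ q)))) (ℕP.*-monoʳ-≤ p (FP.toℕ<n q)))
    where a = proj₁ (F.remQuot {pm} K i)
          q = proj₂ (F.remQuot {pm} K i)

  unit-below-∤ : ∀ K i → ¬ (+ p ∣ + unit-below K i)
  unit-below-∤ K i p∣u = ℕD.>⇒∤ (1+a<p a)
    (ℕD.∣m+n∣m⇒∣n (subst (p ℕD.∣_) (ℕP.+-comm (suc (toℕ a)) (p ℕ.* toℕ q)) (S.∣⇒∣ᵤ p∣u)) (ℕD.m∣m*n (toℕ q)))
    where a = proj₁ (F.remQuot {pm} K i)
          q = proj₂ (F.remQuot {pm} K i)

  unit-below-injective : ∀ K {i j} → unit-below K i ≡ unit-below K j → i ≡ j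
  unit-below-injective K {i} {j} e = remQuot-injective {pm} K (cong₂ _,_
    (FP.toℕ-injective (ℕP.suc-injective same-a)) (FP.toℕ-injective (ℕP.*-cancelˡ-≡ (toℕ q) (toℕ q') p same-pq)))
    where
      a = proj₁ (F.remQuot {pm} K i) ; q = proj₂ (F.remQuot {pm} K i)
      a' = proj₁ (F.remQuot {pm} K j) ; q' = proj₂ (F.remQuot {pm} K j)
      same-a : suc (toℕ a) ≡ suc (toℕ a')
      same-a = trans (sym (unit-mod a (toℕ q))) (trans (cong (_% p) e) (unit-mod a' (toℕ q')))
      same-pq : p ℕ.* toℕ q ≡ p ℕ.* toℕ q'
      same-pq = ℕP.+-cancelˡ-≡ (suc (toℕ a)) _ _ (trans e (cong (ℕ._+ p ℕ.* toℕ q') (sym same-a)))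

square-beats-successor : ∀ r W → 4 ≤ r → 1 ≤ W → suc r ℕ.* W ℕ.+ 2 ≤ r ℕ.* r ℕ.* W
square-beats-successor r@(suc (suc (suc (suc s)))) W _ 1≤W = begin
  suc r ℕ.* W ℕ.+ 2            ≤⟨ ℕP.+-monoʳ-≤ (suc r ℕ.* W) (ℕP.*-monoʳ-≤ 2 1≤W) ⟩
  suc r ℕ.* W ℕ.+ 2 ℕ.* W      ≡⟨ ℕP.*-distribʳ-+ W (suc r) 2 ⟨
  (suc r ℕ.+ 2) ℕ.* W          ≤⟨ ℕP.*-monoˡ-≤ W r+3≤r² ⟩
  r ℕ.* r ℕ.* W                ∎
  where
    open ℕP.≤-Reasoning
    expand : ∀ s → (4 ℕ.+ s) ℕ.* (4 ℕ.+ s) ≡ (suc (4 ℕ.+ s) ℕ.+ 2) ℕ.+ (9 ℕ.+ 7 ℕ.* s ℕ.+ s ℕ.* s)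
    expand = ℕSolver.solve-∀
    r+3≤r² : suc r ℕ.+ 2 ≤ r ℕ.* r
    r+3≤r² = ℕP.≤-trans (ℕP.m≤m+n _ _) (ℕP.≤-reflexive (sym (expand s)))
square-beats-successor 0 _ () _
square-beats-successor 1 _ (s≤s ()) _
square-beats-successor 2 _ (s≤s (s≤s ())) _
square-beats-successor 3 _ (s≤s (s≤s (s≤s ()))) _

module _ {p : ℕ} (pr : Prime p) where
  private instance
    p≢0 : ℕ.NonZero p
    p≢0 = prime⇒nonZero pr
  open Residues p

  -- A zero-divisor x = a + b i of ℤ_p[i] has norm a² + b² ≡ 0: multiplying x y ≡ 0 by
  -- the conjugate of x gives (a² + b²) y ≡ 0 with y ≢ 0.
  norm-of-zero-divisor : ∀ {a b : Fin p} {y} → ¬ IsZero y → ProdZero (a , b) y → + p ∣ ι a * ι a + ι b * ι b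
  norm-of-zero-divisor {a} {b} {c , d} y≢0 pz with + p ∣? ι a * ι a + ι b * ι b
  ... | yes p∣N = p∣N
  ... | no p∤N = ⊥-elim (y≢0 (∣⇒isZero {c , d} (prime-cancel pr p∤N p∣Nc , prime-cancel pr p∤N p∣Nd)))
    where
      A = ι a ; B = ι b ; C = ι c ; D = ι d
      e₁ = proj₁ (prodZero⇒∣ {x = a , b} {c , d} pz)
      e₂ = proj₂ (prodZero⇒∣ {x = a , b} {c , d} pz)
      conj-c : ∀ A B C D → A * (A * C - B * D) + B * (A * D + B * C) ≡ (A * A + B * B) * C
      conj-c A B C D = solve (A ∷ B ∷ C ∷ D ∷ [])
      conj-d : ∀ A B C D → A * (A * D + B * C) - B * (A * C - B * D) ≡ (A * A + B * B) * D
      conj-d A B C D = solve (A ∷ B ∷ C ∷ D ∷ [])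
      p∣Nc : + p ∣ (A * A + B * B) * C
      p∣Nc = ∣-≡ (S.∣m∣n⇒∣m+n (S.∣n⇒∣m*n A e₁) (S.∣n⇒∣m*n B e₂)) (conj-c A B C D)
      p∣Nd : + p ∣ (A * A + B * B) * D
      p∣Nd = ∣-≡ (S.∣m∣n⇒∣m-n (S.∣n⇒∣m*n A e₂) (S.∣n⇒∣m*n B e₁)) (conj-d A B C D)

  -- If a nonzero x = a + b i has norm ≡ 0, then a is a unit: p ∣ a would give p ∣ b².
  unit-coordinate : ∀ {a b : Fin p} → ¬ IsZero (a , b) → + p ∣ ι a * ι a + ι b * ι b → ¬ (+ p ∣ ι a)
  unit-coordinate {a} {b} x≢0 p∣N p∣a =
    x≢0 (∣⇒isZero {a , b} (p∣a , [ id , id ]′ (euclid (ι b) (ι b) pr p∣b²)))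
    where
      p∣b² : + p ∣ ι b * ι b
      p∣b² = S.∣m+n∣m⇒∣n p∣N (S.∣m⇒∣m*n (ι a) p∣a)

-- The vertices of Γ(ℤ_p[i]) are exactly the
-- nonzero multiples t(1 + σ i) and t(1 - σ i), and every element of the first line
-- annihilates every element of the second: the graph is the complete bipartite graph
-- K_{p-1,p-1}, which contains cycles of all even lengths.
module _ {p : ℕ} (pr : Prime p) (p>2 : 2 < p) (σ : ℤ) (p∣σ²+1 : + p ∣ σ * σ + + 1) where
  private instance
    p≢0 : ℕ.NonZero p
    p≢0 = prime⇒nonZero pr
  open Residues p
  open ≡-mod-Reasoning (+ p)

  -- σ ≢ -σ, since p ∤ 2σ.
  σ≢-σ : ¬ (σ ≡ - σ mod + p)
  σ≢-σ (mod-intro p∣σ--σ) = [ ∤-small (s≤s z≤n) p>2 , root-unit pr p∣σ²+1 ]′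
    (euclid (+ 2) σ pr (∣-≡ p∣σ--σ (solve (σ ∷ []))))

  -- The element t (1 + c i) = t + t c i of ℤ_p[i].
  line : ℤ → ℕ → ℤni p
  line c t = reduce (+ t , + t * c)

  lines-annihilate : ∀ t u → ProdZero (line σ t) (line (- σ) u)
  lines-annihilate t u = ∣⇒prodZero-reduce (+ t , + t * σ) (+ u , + u * - σ)
    ( ∣-≡ (S.∣n⇒∣m*n (+ t * + u) p∣σ²+1) (real-part (+ t) (+ u))
    , ∣-≡ (divides (+ 0) refl) (sym (imaginary-part (+ t) (+ u))))
    where
      real-part : ∀ T U → T * U * (σ * σ + + 1) ≡ T * U - (T * σ) * (U * - σ)
      real-part T U = solve (T ∷ U ∷ σ ∷ [])
      imaginary-part : ∀ T U → T * (U * - σ) + (T * σ) * U ≡ + 0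
      imaginary-part T U = solve (T ∷ U ∷ σ ∷ [])

  line-coordinate : ∀ c {t} → t < p → toℕ (proj₁ (line c t)) ≡ t
  line-coordinate c {t} t<p = red-small {t} t<p

  line-nonzero : ∀ c {t} → 0 < t → t < p → ¬ IsZero (line c t)
  line-nonzero c 0<t t<p (t≡0 , _) = ℕP.<⇒≢ 0<t (sym (trans (sym (line-coordinate c t<p)) t≡0))

  line-≡ : ∀ {c c' t u} → line c t ≡ line c' u → + t ≡ + u mod + p × + t * c ≡ + u * c' mod + p
  line-≡ {c} {c'} {t} {u} = reduce-≡ {+ t} {+ t * c} {+ u} {+ u * c'}

  line-injective : ∀ {c c' t u} → t < p → u < p → line c t ≡ line c' u → t ≡ u
  line-injective t<p u<p e = residue-unique t<p u<p (proj₁ (line-≡ e))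

  lines-disjoint : ∀ {t u} → 0 < t → t < p → u < p → line σ t ≢ line (- σ) u
  lines-disjoint {t} {u} 0<t t<p u<p e = σ≢-σ (mod-cancel pr (∤-small 0<t t<p) (begin
    + t * σ        ≈⟨ proj₂ (line-≡ e) ⟩
    + u * - σ      ≡⟨ cong (λ v → + v * - σ) (sym (line-injective t<p u<p e)) ⟩
    + t * - σ      ∎))

  line-vertex⁺ : ∀ {t} → 0 < t → t < p → IsVertex (line σ t)
  line-vertex⁺ {t} 0<t t<p =
    line-nonzero σ 0<t t<p , line (- σ) 1 , line-nonzero (- σ) (s≤s z≤n) (1<p pr) , lines-annihilate t 1

  line-vertex⁻ : ∀ {t} → 0 < t → t < p → IsVertex (line (- σ) t)
  line-vertex⁻ {t} 0<t t<p =
    line-nonzero (- σ) 0<t t<p , line σ 1 , line-nonzero σ (s≤s z≤n) (1<p pr) ,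
    prodZero-sym {x = line σ 1} (lines-annihilate 1 t)

  -- Every vertex a + b i lies on one of the lines: a is a unit and
  -- (b - a σ)(b + a σ) ≡ a² + b² ≡ 0, so b ≡ ± a σ.
  vertex-on-lines : ∀ {a b} → IsVertex (a , b) →
                    0 < toℕ a × ((a , b) ≡ line σ (toℕ a) ⊎ (a , b) ≡ line (- σ) (toℕ a))
  vertex-on-lines {a} {b} (x≢0 , y , y≢0 , pz) =
    ∤⇒0< (unit-coordinate pr x≢0 p∣N) ,
    [ (λ p∣b-aσ → inj₁ (on-line σ (mod-intro p∣b-aσ)))
    , (λ p∣b+aσ → inj₂ (on-line (- σ) (mod-intro (∣-≡ p∣b+aσ (minus-neg (ι b) (ι a))))))
    ]′ (euclid (ι b - ι a * σ) (ι b + ι a * σ) pr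
         (∣-≡ (S.∣m∣n⇒∣m-n p∣N (S.∣n⇒∣m*n (ι a * ι a) p∣σ²+1)) (norm-factors (ι a) (ι b))))
    where
      p∣N : + p ∣ ι a * ι a + ι b * ι b
      p∣N = norm-of-zero-divisor pr {a} {b} y≢0 pz
      minus-neg : ∀ B A → B + A * σ ≡ B - A * - σ
      minus-neg B A = solve (B ∷ A ∷ σ ∷ [])
      norm-factors : ∀ A B → A * A + B * B - A * A * (σ * σ + + 1) ≡ (B - A * σ) * (B + A * σ)
      norm-factors A B = solve (A ∷ B ∷ σ ∷ [])
      on-line : ∀ c → ι b ≡ ι a * c mod + p → (a , b) ≡ line c (toℕ a)
      on-line c b≡ac = trans (sym (reduce-lift (a , b))) (cong (red (ι a) ,_) (red-cong b≡ac))

  -- Writing p = pm + 1, the vertices inject into two copies of {1, …, pm}.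
  module _ (pm : ℕ) (p≡1+pm : p ≡ suc pm) where

    -- a ↦ a - 1, used for a ≠ 0.
    position : Fin p → Fin pm
    position a = F.fromℕ< (position< (toℕ a) (FP.toℕ<n a))
      where
        position< : ∀ i → i < p → i ∸ 1 < pm
        position< zero    _   = ℕP.<-trans (s≤s z≤n) (ℕP.≤-pred (subst (2 <_) p≡1+pm p>2))
        position< (suc i) i<p = ℕP.≤-pred (subst (suc i <_) p≡1+pm i<p)

    position-injective : ∀ {a a' : Fin p} → 0 < toℕ a → 0 < toℕ a' → position a ≡ position a' → toℕ a ≡ toℕ a'
    position-injective {a} {a'} 0<a 0<a' e = shift 0<a 0<a'
      (trans (sym (FP.toℕ-fromℕ< _)) (trans (cong toℕ e) (FP.toℕ-fromℕ< _)))
      where shift : ∀ {i j} → 0 < i → 0 < j → i ∸ 1 ≡ j ∸ 1 → i ≡ j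
            shift {suc i} {suc j} _ _ = cong suc

    placement : ℤni p → Fin pm ⊎ Fin pm
    placement (a , b) with ≡-dec FP._≟_ FP._≟_ (a , b) (line σ (toℕ a))
    ... | yes _ = inj₁ (position a)
    ... | no _  = inj₂ (position a)

    placement⁺ : ∀ {a b} → (a , b) ≡ line σ (toℕ a) → placement (a , b) ≡ inj₁ (position a)
    placement⁺ {a} {b} on-line with ≡-dec FP._≟_ FP._≟_ (a , b) (line σ (toℕ a))
    ... | yes _ = refl
    ... | no off-line = ⊥-elim (off-line on-line)

    placement⁻ : ∀ {a b} → 0 < toℕ a → (a , b) ≡ line (- σ) (toℕ a) → placement (a , b) ≡ inj₂ (position a)
    placement⁻ {a} {b} 0<a on-line with ≡-dec FP._≟_ FP._≟_ (a , b) (line σ (toℕ a))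
    ... | yes on-other = ⊥-elim (lines-disjoint 0<a (FP.toℕ<n a) (FP.toℕ<n a) (trans (sym on-other) on-line))
    ... | no _ = refl

    same-line : ∀ {c a a' b b'} → (a , b) ≡ line c (toℕ a) → (a' , b') ≡ line c (toℕ a') → toℕ a ≡ toℕ a' →
                (a , b) ≡ (a' , b')
    same-line {c} x≡ y≡ a≡a' = trans x≡ (trans (cong (line c) a≡a') (sym y≡))

    placement-injective : ∀ {x y} → IsVertex x → IsVertex y → placement x ≡ placement y → x ≡ y
    placement-injective {a , b} {a' , b'} x-vtx y-vtx e = compare (vertex-on-lines x-vtx) (vertex-on-lines y-vtx)
      where
        compare : 0 < toℕ a × ((a , b) ≡ line σ (toℕ a) ⊎ (a , b) ≡ line (- σ) (toℕ a)) →
                  0 < toℕ a' × ((a' , b') ≡ line σ (toℕ a') ⊎ (a' , b') ≡ line (- σ) (toℕ a')) →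
                  (a , b) ≡ (a' , b')
        compare (0<a , inj₁ x≡) (0<a' , inj₁ y≡) = same-line x≡ y≡ (position-injective 0<a 0<a'
          (inj₁-injective (trans (sym (placement⁺ x≡)) (trans e (placement⁺ y≡)))))
        compare (0<a , inj₂ x≡) (0<a' , inj₂ y≡) = same-line x≡ y≡ (position-injective 0<a 0<a'
          (inj₂-injective (trans (sym (placement⁻ 0<a x≡)) (trans e (placement⁻ 0<a' y≡)))))
        compare (0<a , inj₁ x≡) (0<a' , inj₂ y≡) with () ← trans (sym (placement⁺ x≡)) (trans e (placement⁻ 0<a' y≡))
        compare (0<a , inj₂ x≡) (0<a' , inj₁ y≡) with () ← trans (sym (placement⁻ 0<a x≡)) (trans e (placement⁺ y≡))

    order-prime : order p ≤ pm ℕ.+ pm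
    order-prime = order-≤ (F.join pm pm ∘ placement) λ x-vtx y-vtx e →
      placement-injective x-vtx y-vtx (trans (sym (FP.splitAt-join pm pm _)) (trans (cong (F.splitAt pm) e) (FP.splitAt-join pm pm _)))

  -- Even positions of a cycle go on the line through 1 + σ i, odd ones on 1 - σ i.
  side : Parity → ℤ
  side 0ℙ = σ
  side 1ℙ = - σ

  side-vertex : ∀ c {t} → 0 < t → t < p → IsVertex (line (side c) t)
  side-vertex 0ℙ = line-vertex⁺
  side-vertex 1ℙ = line-vertex⁻

  side-adjacent : ∀ c {t u} → 0 < t → t < p → 0 < u → u < p → Adj (line (side c) t) (line (side (c ⁻¹)) u)
  side-adjacent 0ℙ {t} {u} 0<t t<p _ u<p = lines-disjoint 0<t t<p u<p , lines-annihilate t u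
  side-adjacent 1ℙ {t} {u} _ t<p 0<u u<p =
    (λ e → lines-disjoint 0<u u<p t<p (sym e)) , prodZero-sym {x = line σ u} (lines-annihilate u t)

  side-injective : ∀ c c' {t u} → 0 < t → t < p → 0 < u → u < p → line (side c) t ≡ line (side c') u → c ≡ c'
  side-injective 0ℙ 0ℙ _ _ _ _ _ = refl
  side-injective 1ℙ 1ℙ _ _ _ _ _ = refl
  side-injective 0ℙ 1ℙ 0<t t<p _ u<p e = ⊥-elim (lines-disjoint 0<t t<p u<p e)
  side-injective 1ℙ 0ℙ _ t<p 0<u u<p e = ⊥-elim (lines-disjoint 0<u u<p t<p (sym e))

  cycle-point : ℕ → ℤni p
  cycle-point i = line (side (ℕ.parity i)) (suc ⌊ i /2⌋)

  parity-next : ∀ j (i : Fin (suc (j ℕ.+ suc j))) → ℕ.parity (toℕ (next i)) ≡ ℕ.parity (toℕ i) ⁻¹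
  parity-next j i with next-cases i
  ... | inj₁ (_ , next≡1+i) = trans (cong ℕ.parity next≡1+i) (sym (ℙP.⁻¹-selfInverse (ℙP.suc-homo-⁻¹ (toℕ i))))
  ... | inj₂ (i≡last , next≡0) = trans (cong ℕ.parity next≡0) (sym (trans (cong (λ k → ℕ.parity k ⁻¹) i≡last)
          (trans (ℙP.⁻¹-selfInverse (ℙP.suc-homo-⁻¹ (j ℕ.+ suc j))) (parity-double (suc j)))))

  even-cycle : ∀ j → suc j < p → HasCycleOfLength p (suc j ℕ.+ suc j)
  even-cycle j 1+j<p = record
    { vtx      = cycle-point ∘ toℕ
    ; distinct = λ {i} {i'} e → FP.toℕ-injective (parity-half-injective (toℕ i) (toℕ i')
                   (side-injective _ _ (s≤s z≤n) (bound i) (s≤s z≤n) (bound i') e)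
                   (ℕP.suc-injective (line-injective {side (ℕ.parity (toℕ i))} {side (ℕ.parity (toℕ i'))} (bound i) (bound i') e)))
    ; isVtx    = λ i → side-vertex (ℕ.parity (toℕ i)) (s≤s z≤n) (bound i)
    ; adjacent = λ i → subst (λ c → Adj (cycle-point (toℕ i)) (line (side c) (suc ⌊ toℕ (next i) /2⌋)))
                   (sym (parity-next j i)) (side-adjacent (ℕ.parity (toℕ i)) (s≤s z≤n) (bound i) (s≤s z≤n) (bound (next i)))
    }
    where
      bound : ∀ (i : Fin (suc (j ℕ.+ suc j))) → suc ⌊ toℕ i /2⌋ < p
      bound i = ℕP.≤-<-trans (half-< (toℕ i) (suc j) (FP.toℕ<n i)) 1+j<p

  -- Γ(ℤ_p[i]) is bipancyclic: an even length 2q ≤ order p ≤ 2(p - 1) has q ≤ p - 1.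
  bipancyclic-prime : ∀ pm → p ≡ suc pm → Bipancyclic p
  bipancyclic-prime pm p≡1+pm k 4≤k k≤order (ℕD.divides q k≡q*2) =
    subst (HasCycleOfLength p) (sym k≡q+q) (cycle q q≤pm (ℕP.<-≤-trans (s≤s z≤n) (ℕP.*-cancelʳ-≤ 2 q 2 2≤q*2)))
    where
      k≡q+q : k ≡ q ℕ.+ q
      k≡q+q = trans k≡q*2 (trans (ℕP.*-comm q 2) (cong (q ℕ.+_) (ℕP.+-identityʳ q)))
      2≤q*2 : 2 ℕ.* 2 ≤ q ℕ.* 2
      2≤q*2 = subst (4 ≤_) k≡q*2 4≤k
      q≤pm : q ≤ pm
      q≤pm = ℕP.*-cancelʳ-≤ q pm 2 (subst₂ _≤_ k≡q*2 (trans refl (solve-double pm))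
               (ℕP.≤-trans k≤order (order-prime pm p≡1+pm)))
        where solve-double : ∀ m → m ℕ.+ m ≡ m ℕ.* 2
              solve-double m = trans (cong (m ℕ.+_) (sym (ℕP.+-identityʳ m))) (ℕP.*-comm 2 m)
      cycle : ∀ q → q ≤ pm → 0 < q → HasCycleOfLength p (q ℕ.+ q)
      cycle (suc j) 1+j≤pm _ = even-cycle j (subst (suc j <_) (sym p≡1+pm) (s≤s 1+j≤pm))

module _ {p : ℕ} (pr : Prime p) (p>2 : 2 < p) (σ : ℤ) (p∣σ²+1 : + p ∣ σ * σ + + 1) where

  p∤2 : ¬ (+ p ∣ + 2)
  p∤2 = ∤-small (s≤s z≤n) p>2

  -- Reduction modulo p composed with i ↦ -σ: a ring homomorphism ℤ[i] → ℤ_p.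
  ψ : 𝔾 → ℤ
  ψ (a , b) = a - b * σ

  -- ψ is multiplicative modulo p, because σ² ≡ -1.
  ψ-· : ∀ z w → ψ (z · w) ≡ ψ z * ψ w mod + p
  ψ-· (a , b) (c , d) = mod-via (- (b * d) * (σ * σ + + 1)) (difference a b c d) (S.∣n⇒∣m*n (- (b * d)) p∣σ²+1)
    where
      difference : ∀ a b c d → (a * c - b * d) - (a * d + b * c) * σ - (a - b * σ) * (c - d * σ) ≡
                               - (b * d) * (σ * σ + + 1)
      difference a b c d = solve (a ∷ b ∷ c ∷ d ∷ σ ∷ [])

  ψ-^ : ∀ z k → ψ (z ^𝔾 k) ≡ ψ z ℤ.^ k mod + p
  ψ-^ z zero    = ≡⇒mod (ψ-one σ)
    where ψ-one : ∀ s → + 1 - + 0 * s ≡ + 1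
          ψ-one s = solve (s ∷ [])
  ψ-^ z (suc k) = mod-trans (ψ-· (z ^𝔾 k) z)
                    (mod-trans (*-congʳ (ψ z) (ψ-^ z k)) (≡⇒mod (ℤP.*-comm (ψ z ℤ.^ k) (ψ z))))

  -- The Gaussian integer σ - i, of norm σ² + 1 ≡ 0 (mod p).
  generator : 𝔾
  generator = (σ , - + 1)

  norm-generator : norm generator ≡ σ * σ + + 1
  norm-generator = identity σ
    where identity : ∀ s → s * s + - + 1 * - + 1 ≡ s * s + + 1
          identity s = solve (s ∷ [])

  ψ-generator : ψ generator ≡ + 2 * σ
  ψ-generator = identity σ
    where identity : ∀ s → s - - + 1 * s ≡ + 2 * s
          identity s = solve (s ∷ [])

  p^k∣norm : ∀ k → + (p ^ k) ∣ norm (generator ^𝔾 k)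
  p^k∣norm k = subst₂ _∣_ (sym (pos-^ p k)) (sym (trans (norm-^ generator k) (cong (ℤ._^ k) norm-generator)))
                 (^-mono-∣ k p∣σ²+1)

  -- (σ - i)^k is not divisible by p, since ψ maps it to (2σ)^k.
  power-not-divisible : ∀ k → ¬ (+ p ∣𝔾 generator ^𝔾 k)
  power-not-divisible k (p∣a , p∣b) =
    prime-∤-^ pr 2σ-unit k (≡0⇒∣ (mod-trans (mod-sym (mod-trans (ψ-^ generator k) (≡⇒mod (cong (ℤ._^ k) ψ-generator))))
      (∣⇒≡0 (S.∣m∣n⇒∣m-n p∣a (S.∣m⇒∣m*n σ p∣b)))))
    where
      2σ-unit : ¬ (+ p ∣ + 2 * σ)
      2σ-unit p∣2σ = [ p∤2 , root-unit pr p∣σ²+1 ]′ (euclid (+ 2) σ pr p∣2σ)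

  -- The case m = k + 2.  Write z = (σ - i)^m = Za + Zb i, n = p^m and Q = p^(m-1).
  -- The elements t z + w p with p ∤ t, w are vertices whose neighbours all lie in p ℤ_n[i].
  module PrimePower (k : ℕ) where
    m n Q : ℕ
    m = suc (suc k)
    n = p ^ m
    Q = p ^ suc k

    instance
      p≢0 : ℕ.NonZero p
      p≢0 = prime⇒nonZero pr
      n≢0 : ℕ.NonZero n
      n≢0 = ℕP.m^n≢0 p m
      Q≢0 : ℤ.NonZero (+ Q)
      Q≢0 = ℕP.m^n≢0 p (suc k)
    open Residues n

    Za Zb : ℤ
    Za = proj₁ (generator ^𝔾 m)
    Zb = proj₂ (generator ^𝔾 m)

    n∣N : + n ∣ Za * Za + Zb * Zb
    n∣N = p^k∣norm m

    z≢0 : ¬ (+ p ∣ Za × + p ∣ Zb)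
    z≢0 = power-not-divisible m

    n≡pQ : + n ≡ + p * + Q
    n≡pQ = ℤP.pos-* p Q

    p∣Q : + p ∣ + Q
    p∣Q = divides (+ (p ^ k)) (trans (ℤP.pos-* p (p ^ k)) (ℤP.*-comm (+ p) _))

    cancel-p : ∀ {x} → + n ∣ + p * x → + Q ∣ x
    cancel-p {x} d = S.*-cancelˡ-∣ (+ p) (subst (_∣ + p * x) n≡pQ d)

    cancel-Q : ∀ {x} → + n ∣ + Q * x → + p ∣ x
    cancel-Q {x} d = S.*-cancelˡ-∣ (+ Q) (subst (_∣ + Q * x) (trans n≡pQ (ℤP.*-comm (+ p) (+ Q))) d)

    candidate : ℕ → ℕ → 𝔾
    candidate t w = (+ t * Za + + w * + p , + t * Zb)

    annihilator : 𝔾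
    annihilator = (+ Q * Za , - (+ Q * Zb))

    -- (t z + w p) Q z̄ = t Q N(z) + w n z̄ ≡ 0 (mod n).
    annihilates : ∀ t w → + n ∣𝔾 candidate t w · annihilator
    annihilates t w =
        ∣-≡ (S.∣m∣n⇒∣m+n (S.∣n⇒∣m*n (+ t * + Q) n∣N) (∣-≡ (S.∣n⇒∣m*n (+ w * Za) S.∣-refl) (cong (+ w * Za *_) n≡pQ)))
            (sym (real-part (+ t) (+ w) Za Zb (+ p) (+ Q)))
      , ∣-≡ (S.∣m⇒∣-m (∣-≡ (S.∣n⇒∣m*n (+ w * Zb) S.∣-refl) (cong (+ w * Zb *_) n≡pQ)))
            (sym (imaginary-part (+ t) (+ w) Za Zb (+ p) (+ Q)))
      where
        real-part : ∀ t w a b p q → (t * a + w * p) * (q * a) - (t * b) * - (q * b) ≡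
                                    (t * q) * (a * a + b * b) + (w * a) * (p * q)
        real-part t w a b p q = solve (t ∷ w ∷ a ∷ b ∷ p ∷ q ∷ [])
        imaginary-part : ∀ t w a b p q → (t * a + w * p) * - (q * b) + (t * b) * (q * a) ≡ - ((w * b) * (p * q))
        imaginary-part t w a b p q = solve (t ∷ w ∷ a ∷ b ∷ p ∷ q ∷ [])

    p∣n : + p ∣ + n
    p∣n = divides (+ Q) (trans n≡pQ (ℤP.*-comm (+ p) (+ Q)))

    -- For p ∤ t, t z + w p ≢ 0 (mod n), since it is t z modulo p.
    candidate-not-divisible : ∀ {t w} → ¬ (+ p ∣ + t) → ¬ (+ n ∣𝔾 candidate t w)
    candidate-not-divisible {t} {w} p∤t (n∣x₁ , n∣x₂) = z≢0
      ( prime-cancel pr p∤t (S.∣m+n∣n⇒∣m (S.∣-trans p∣n n∣x₁) (S.∣n⇒∣m*n (+ w) S.∣-refl))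
      , prime-cancel pr p∤t (S.∣-trans p∣n n∣x₂))

    -- Q z̄ ≢ 0 (mod n), since z̄ ≢ 0 (mod p).
    annihilator-not-divisible : ¬ (+ n ∣𝔾 annihilator)
    annihilator-not-divisible (n∣x₁ , n∣x₂) =
      z≢0 (cancel-Q n∣x₁ , cancel-Q (subst (+ n ∣_) (ℤP.neg-involutive _) (S.∣m⇒∣-m n∣x₂)))

    candidate-vertex : ∀ {t} w → ¬ (+ p ∣ + t) → IsVertex (reduce (candidate t w))
    candidate-vertex {t} w p∤t =
        (λ x≡0 → candidate-not-divisible {t} {w} p∤t (isZero-reduce⇒∣ (candidate t w) x≡0))
      , reduce annihilator
      , (λ y≡0 → annihilator-not-divisible (isZero-reduce⇒∣ annihilator y≡0))
      , ∣⇒prodZero-reduce (candidate t w) annihilator (annihilates t w)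

    -- Modulo p, t z + w p ≡ t z; so when p ∤ t, z annihilates every y with (t z + w p) y ≡ 0.
    z-annihilates : ∀ {t w C D} → ¬ (+ p ∣ + t) → + n ∣𝔾 candidate t w · (C , D) →
                    + p ∣ Za * C - Zb * D × + p ∣ Za * D + Zb * C
    z-annihilates {t} {w} {C} {D} p∤t (E₁ , E₂) =
        prime-cancel pr p∤t (∣-≡ (S.∣m∣n⇒∣m-n (S.∣-trans p∣n E₁) (S.∣n⇒∣m*n (+ w * C) S.∣-refl))
          (identity₁ (+ t) (+ w) Za Zb C D (+ p)))
      , prime-cancel pr p∤t (∣-≡ (S.∣m∣n⇒∣m-n (S.∣-trans p∣n E₂) (S.∣n⇒∣m*n (+ w * D) S.∣-refl))
          (identity₂ (+ t) (+ w) Za Zb C D (+ p)))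
      where
        identity₁ : ∀ T W a b C D P → (T * a + W * P) * C - T * b * D - W * C * P ≡ T * (a * C - b * D)
        identity₁ T W a b C D P = solve (T ∷ W ∷ a ∷ b ∷ C ∷ D ∷ P ∷ [])
        identity₂ : ∀ T W a b C D P → (T * a + W * P) * D + T * b * C - W * D * P ≡ T * (a * D + b * C)
        identity₂ T W a b C D P = solve (T ∷ W ∷ a ∷ b ∷ C ∷ D ∷ P ∷ [])

    -- Multiplying by z̄ gives t N(z) y + p w z̄ y ≡ 0 (mod n); since n ∣ N(z) and p ∣ Q,
    -- z̄ annihilates y modulo p when p ∤ w.
    z̄-annihilates : ∀ {t w C D} → ¬ (+ p ∣ + w) → + n ∣𝔾 candidate t w · (C , D) →
                    + p ∣ Za * C + Zb * D × + p ∣ Za * D - Zb * C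
    z̄-annihilates {t} {w} {C} {D} p∤w (E₁ , E₂) =
        cancel-pw (∣-≡ (S.∣m∣n⇒∣m-n (S.∣m∣n⇒∣m+n (S.∣n⇒∣m*n Za E₁) (S.∣n⇒∣m*n Zb E₂)) (S.∣n⇒∣m*n (+ t * C) n∣N))
          (identity₁ (+ t) (+ w) Za Zb C D (+ p)))
      , cancel-pw (∣-≡ (S.∣m∣n⇒∣m-n (S.∣m∣n⇒∣m-n (S.∣n⇒∣m*n Za E₂) (S.∣n⇒∣m*n Zb E₁)) (S.∣n⇒∣m*n (+ t * D) n∣N))
          (identity₂ (+ t) (+ w) Za Zb C D (+ p)))
      where
        cancel-pw : ∀ {u} → + n ∣ + p * (+ w * u) → + p ∣ u
        cancel-pw n∣pwu = prime-cancel pr p∤w (S.∣-trans p∣Q (cancel-p n∣pwu))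
        identity₁ : ∀ T W a b C D P → a * ((T * a + W * P) * C - T * b * D) + b * ((T * a + W * P) * D + T * b * C)
                                      - T * C * (a * a + b * b) ≡ P * (W * (a * C + b * D))
        identity₁ T W a b C D P = solve (T ∷ W ∷ a ∷ b ∷ C ∷ D ∷ P ∷ [])
        identity₂ : ∀ T W a b C D P → a * ((T * a + W * P) * D + T * b * C) - b * ((T * a + W * P) * C - T * b * D)
                                      - T * D * (a * a + b * b) ≡ P * (W * (a * D - b * C))
        identity₂ T W a b C D P = solve (T ∷ W ∷ a ∷ b ∷ C ∷ D ∷ P ∷ [])

    candidate-neighbours : ∀ {t w} → ¬ (+ p ∣ + t) → ¬ (+ p ∣ + w) →
                           ∀ {y} → ProdZero (reduce (candidate t w)) y → + p ∣𝔾 lift y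
    candidate-neighbours {t} {w} p∤t p∤w {y} pz =
      annihilated-by-conjugates pr p∤2 z≢0 (proj₁ zy) (proj₂ zy) (proj₁ z̄y) (proj₂ z̄y)
      where
        n∣xy = prodZero-reduce⇒∣ (candidate t w) {y} pz
        zy = z-annihilates {t} {w} p∤t n∣xy
        z̄y = z̄-annihilates {t} {w} p∤w n∣xy

    z-unit-coordinate : ¬ (+ p ∣ Za) ⊎ ¬ (+ p ∣ Zb)
    z-unit-coordinate with + p ∣? Za | + p ∣? Zb
    ... | no p∤Za | _        = inj₁ p∤Za
    ... | yes _   | no p∤Zb  = inj₂ p∤Zb
    ... | yes p∣Za | yes p∣Zb = ⊥-elim (z≢0 (p∣Za , p∣Zb))

    cancel-z : ∀ j {x} → + (p ^ j) ∣ x * Za → + (p ^ j) ∣ x * Zb → + (p ^ j) ∣ x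
    cancel-z j {x} d₁ d₂ = [ (λ p∤Za → prime-power-cancel j x Za pr p∤Za d₁)
                           , (λ p∤Zb → prime-power-cancel j x Zb pr p∤Zb d₂) ]′ z-unit-coordinate

    -- t z + w p determines t < n and w < Q: multiplying the difference by z̄ shows
    -- Q ∣ Δw, and then n ∣ Δt z gives n ∣ Δt.
    candidate-injective : ∀ {t w t' w'} → t < n → t' < n → w < Q → w' < Q →
                          reduce (candidate t w) ≡ reduce (candidate t' w') → t ≡ t' × w ≡ w'
    candidate-injective {t} {w} {t'} {w'} t<n t'<n w<Q w'<Q e = t≡t' , w≡w'
      where
        T = + t ; T' = + t' ; W = + w ; W' = + w' ; P = + p
        congruent = reduce-≡ {T * Za + W * P} {T * Zb} {T' * Za + W' * P} {T' * Zb} e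
        d₁ = divides-diff (proj₁ congruent)
        d₂ = divides-diff (proj₂ congruent)
        Q∣Δw : + Q ∣ W - W'
        Q∣Δw = cancel-z (suc k)
          (cancel-p (∣-≡ (S.∣m∣n⇒∣m-n (S.∣m∣n⇒∣m+n (S.∣n⇒∣m*n Za d₁) (S.∣n⇒∣m*n Zb d₂)) (S.∣n⇒∣m*n (T - T') n∣N))
                         (identity₁ T T' W W' Za Zb P)))
          (cancel-p (∣-≡ (S.∣m∣n⇒∣m-n (S.∣n⇒∣m*n Zb d₁) (S.∣n⇒∣m*n Za d₂)) (identity₂ T T' W W' Za Zb P)))
          where
            identity₁ : ∀ T T' W W' a b P → a * ((T * a + W * P) - (T' * a + W' * P)) + b * (T * b - T' * b)
                                            - (T - T') * (a * a + b * b) ≡ P * ((W - W') * a)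
            identity₁ T T' W W' a b P = solve (T ∷ T' ∷ W ∷ W' ∷ a ∷ b ∷ P ∷ [])
            identity₂ : ∀ T T' W W' a b P → b * ((T * a + W * P) - (T' * a + W' * P)) - a * (T * b - T' * b)
                                            ≡ P * ((W - W') * b)
            identity₂ T T' W W' a b P = solve (T ∷ T' ∷ W ∷ W' ∷ a ∷ b ∷ P ∷ [])
        w≡w' : w ≡ w'
        w≡w' = residue-unique w<Q w'<Q (mod-intro Q∣Δw)
        n∣Δw*p : + n ∣ (W - W') * P
        n∣Δw*p = subst (_∣ (W - W') * P) (trans (ℤP.*-comm (+ Q) P) (sym n≡pQ)) (S.*-monoˡ-∣ P Q∣Δw)
        t≡t' : t ≡ t'
        t≡t' = residue-unique t<n t'<n (mod-intro (cancel-z m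
          (∣-≡ (S.∣m∣n⇒∣m-n d₁ n∣Δw*p) (identity₃ T T' W W' Za P))
          (∣-≡ d₂ (identity₄ T T' Zb))))
          where
            identity₃ : ∀ T T' W W' a P → (T * a + W * P) - (T' * a + W' * P) - (W - W') * P ≡ (T - T') * a
            identity₃ T T' W W' a P = solve (T ∷ T' ∷ W ∷ W' ∷ a ∷ P ∷ [])
            identity₄ : ∀ T T' b → T * b - T' * b ≡ (T - T') * b
            identity₄ T T' b = solve (T ∷ T' ∷ b ∷ [])

module _ {p : ℕ} (pr : Prime p) (p>2 : 2 < p) (σ : ℤ) (p∣σ²+1 : + p ∣ σ * σ + + 1)
         (pm : ℕ) (p≡1+pm : p ≡ suc pm) (4≤pm : 4 ≤ pm) (k : ℕ) where
  open PrimePower pr p>2 σ p∣σ²+1 k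
  open Residues n

  Q' M : ℕ
  Q' = p ^ k
  M  = (pm ℕ.* Q) ℕ.* (pm ℕ.* Q')

  family : Fin M → ℤni n
  family j = reduce (candidate (unit-below p≡1+pm Q (proj₁ r)) (unit-below p≡1+pm Q' (proj₂ r)))
    where r = F.remQuot {pm ℕ.* Q} (pm ℕ.* Q') j

  family-injective : Injective _≡_ _≡_ family
  family-injective {j} {j'} e = remQuot-injective {pm ℕ.* Q} (pm ℕ.* Q') (cong₂ _,_
      (unit-below-injective p≡1+pm Q (proj₁ same))
      (unit-below-injective p≡1+pm Q' (proj₂ same)))
    where
      r = F.remQuot {pm ℕ.* Q} (pm ℕ.* Q') j
      r' = F.remQuot {pm ℕ.* Q} (pm ℕ.* Q') j'
      same = candidate-injective
        (unit-below-< p≡1+pm Q (proj₁ r)) (unit-below-< p≡1+pm Q (proj₁ r'))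
        (unit-below-< p≡1+pm Q' (proj₂ r)) (unit-below-< p≡1+pm Q' (proj₂ r')) e

  family-vertex : ∀ j → IsVertex (family j)
  family-vertex j = candidate-vertex (unit-below p≡1+pm Q' (proj₂ r)) (unit-below-∤ p≡1+pm Q (proj₁ r))
    where r = F.remQuot {pm ℕ.* Q} (pm ℕ.* Q') j

  family-neighbours : ∀ j y → ProdZero (family j) y → + p ∣𝔾 lift y
  family-neighbours j y = candidate-neighbours {unit-below p≡1+pm Q (proj₁ r)} {unit-below p≡1+pm Q' (proj₂ r)}
    (unit-below-∤ p≡1+pm Q (proj₁ r)) (unit-below-∤ p≡1+pm Q' (proj₂ r))
    where r = F.remQuot {pm ℕ.* Q} (pm ℕ.* Q') j

  quotient-< : ∀ (c : Fin n) → toℕ c ℕ./ p < Q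
  quotient-< c = ℕDM.m<n*o⇒m/o<n (subst (toℕ c <_) (ℕP.*-comm p Q) (FP.toℕ<n c))

  divisible-code : ℤni n → Fin (Q ℕ.* Q)
  divisible-code (c , d) = F.combine (F.fromℕ< (quotient-< c)) (F.fromℕ< (quotient-< d))

  divisible-code-injective : ∀ {y y'} → + p ∣𝔾 lift y → + p ∣𝔾 lift y' → divisible-code y ≡ divisible-code y' → y ≡ y'
  divisible-code-injective {c , d} {c' , d'} (p∣c , p∣d) (p∣c' , p∣d') e with FP.combine-injective _ _ _ _ e
  ... | same-c , same-d = cong₂ _,_ (from-quotient p∣c p∣c' same-c) (from-quotient p∣d p∣d' same-d)
    where
      from-quotient : ∀ {x x' : Fin n} → + p ∣ ι x → + p ∣ ι x' →
                      F.fromℕ< (quotient-< x) ≡ F.fromℕ< (quotient-< x') → x ≡ x'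
      from-quotient {x} {x'} p∣x p∣x' e′ = FP.toℕ-injective (ℕDM./-cancelʳ-≡ (S.∣⇒∣ᵤ p∣x) (S.∣⇒∣ᵤ p∣x')
        (trans (sym (FP.toℕ-fromℕ< (quotient-< x))) (trans (cong toℕ e′) (FP.toℕ-fromℕ< (quotient-< x')))))

  family-size : Q ℕ.* Q ℕ.+ 2 ≤ M
  family-size = begin
    Q ℕ.* Q ℕ.+ 2                     ≡⟨ cong (ℕ._+ 2) (trans (ℕP.*-assoc p Q' Q) (cong (p ℕ.*_) (ℕP.*-comm Q' Q))) ⟩
    p ℕ.* (Q ℕ.* Q') ℕ.+ 2            ≡⟨ cong (λ x → x ℕ.* (Q ℕ.* Q') ℕ.+ 2) p≡1+pm ⟩
    suc pm ℕ.* (Q ℕ.* Q') ℕ.+ 2       ≤⟨ square-beats-successor pm (Q ℕ.* Q') 4≤pm (ℕP.*-mono-≤ 1≤Q 1≤Q') ⟩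
    pm ℕ.* pm ℕ.* (Q ℕ.* Q')          ≡⟨ regroup pm Q Q' ⟩
    M                                 ∎
    where
      open ℕP.≤-Reasoning
      1≤Q : 1 ≤ Q
      1≤Q = ℕP.m^n>0 p (suc k)
      1≤Q' : 1 ≤ Q'
      1≤Q' = ℕP.m^n>0 p k
      regroup : ∀ a b c → a ℕ.* a ℕ.* (b ℕ.* c) ≡ (a ℕ.* b) ℕ.* (a ℕ.* c)
      regroup = ℕSolver.solve-∀

  -- A near-spanning cycle would give more than Q² + 1 distinct successors in p ℤ_n[i].
  prime-power-not-bipancyclic : ¬ Bipancyclic n
  prime-power-not-bipancyclic bip = too-many-successors (near-spanning-cycle bip 5≤order)
    where
      2≤Q : 2 ≤ Q
      2≤Q = ℕP.≤-trans (ℕP.<⇒≤ p>2) (ℕP.m≤m*n p Q' {{ℕP.m^n≢0 p k}})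
      5≤order : 5 ≤ order n
      5≤order = ℕP.≤-trans (ℕP.n≤1+n 5) (ℕP.≤-trans (ℕP.+-monoˡ-≤ 2 (ℕP.*-mono-≤ 2≤Q 2≤Q))
                  (ℕP.≤-trans family-size (order-≥ family family-injective family-vertex)))
      too-many-successors : ∃[ K ] (Cycle n K × order n ≤ suc (suc K)) → ⊥
      too-many-successors (K , C , order≤K+2) =
        ℕP.1+n≰n (ℕP.≤-trans (ℕP.≤-reflexive (ℕP.+-comm 2 (Q ℕ.* Q))) (ℕP.≤-trans family-size
        (neighbourhood-bound C order≤K+2 family family-injective family-vertex
           (λ y → + p ∣𝔾 lift y) family-neighbours divisible-code divisible-code-injective)))

theorem2p3 : (p m : ℕ) → Prime p → p % 4 ≡ 1 → 1 ≤ m →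
    (Bipancyclic (p ^ m) → m ≡ 1) × (m ≡ 1 → Bipancyclic (p ^ m))
theorem2p3 p m pr p%4≡1 1≤m = only-if m 1≤m , if
  where
    q = proj₁ (one-mod-four pr p%4≡1)
    pm = q ℕ.* 4
    p≡1+pm : p ≡ suc pm
    p≡1+pm = proj₂ (proj₂ (one-mod-four pr p%4≡1))
    4≤pm : 4 ≤ pm
    4≤pm = ℕP.*-monoˡ-≤ 4 (proj₁ (proj₂ (one-mod-four pr p%4≡1)))
    p>2 : 2 < p
    p>2 = subst (2 <_) (sym p≡1+pm) (s≤s (ℕP.≤-trans (ℕP.n≤1+n 2) (ℕP.≤-trans (ℕP.n≤1+n 3) 4≤pm)))
    s = proj₁ (sqrt-minus-one pr p%4≡1)
    p∣s²+1 = proj₂ (sqrt-minus-one pr p%4≡1)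
    -- m = 1: Γ(ℤ_p[i]) is complete bipartite.
    if : m ≡ 1 → Bipancyclic (p ^ m)
    if refl = subst Bipancyclic (sym (ℕP.*-identityʳ p)) (bipancyclic-prime pr p>2 (+ s) p∣s²+1 pm p≡1+pm)
    -- m ≥ 2: too many vertices have all their neighbours in p ℤ_{p^m}[i].
    only-if : ∀ m → 1 ≤ m → Bipancyclic (p ^ m) → m ≡ 1
    only-if 1 _ _ = refl
    only-if (suc (suc k)) _ bip = ⊥-elim (prime-power-not-bipancyclic pr p>2 (+ s) p∣s²+1 pm p≡1+pm 4≤pm k bip)
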